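{- Let $\Delta\ge 300$ be an integer. Let $G$ be a finite graph of maximum degree less than $\Delta$ and $L$ a list assignment of $G$ (on vertices and edges) in which every list has size at least $4.25\Delta$. Then for every vertex $v$ of $G$, $$|C_L(G)|\ge 1.62\Delta\,|C_L(G\setminus\{v\})|,$$ and for every edge $e$ of $G$, $$|C_L(G)|\ge 4.2\Delta\,|C_L(G\setminus\{e\})|.$$
   Context: A sequence $s_1\ldots s_{2k}$ ($k\ge1$) is a square if $s_i=s_{i+k}$ for all $i$; it is non-repetitive if it has no consecutive subsequence that is a square. Elements of a graph are its vertices and edges. A mixed-path of $G$ is an alternating sequence of vertices and edges in which consecutive elements are incident in $G$, with no element repeated. For a set $S$ of elements of $G$, $G\setminus S$ denotes the structure obtained by deleting exactly the elements of $S$ (an edge is not deleted when one of its endpoints is deleted); the mixed-paths of $G\setminus S$ are the mixed-paths of $G$ all of whose elements lie outside $S$. A coloring of the elements of $G\setminus S$ is a weak total Thue coloring if the color sequence of every mixed-path of $G\setminus S$ is non-repetitive. $L$ assigns to each element a set of colors, and $C_L(G\setminus S)$ is the set of weak total Thue colorings of $G\setminus S$ in which every element $y$ receives a color from $L(y)$ (the empty structure has exactly one coloring). -}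

module Defs where

open import Data.Nat using (ℕ; _<_)
open import Data.Fin using (Fin; _≟_)
open import Data.List using (List; []; _∷_; _++_; map; length; filter)
open import Data.List.Base using (allFin)
open import Data.Maybe using (Maybe; just; nothing)
open import Data.Vec using (Vec; lookup)
open import Data.Sum using (_⊎_; inj₁; inj₂)
open import Data.Product using (_×_; Σ; ∃; ∃-syntax; _,_)
open import Data.Empty using (⊥)
open import Relation.Nullary using (¬_)
open import Relation.Nullary.Decidable using (_⊎-dec_)
open import Relation.Binary.PropositionalEquality using (_≡_; _≢_)
open import Data.List.Membership.Propositional using (_∈_; _∉_)
open import Data.List.Relation.Unary.All using (All)
open import Data.List.Relation.Unary.Linked using (Linked)
open import Data.List.Relation.Unary.Unique.Propositional using (Unique)
open import Function.Bundles using (_⇔_)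

record Graph : Set where
  field
    n m    : ℕ
    src tgt : Fin m → Fin n
    noLoop : ∀ e → src e ≢ tgt e
    simple : ∀ e f → ((src e ≡ src f) × (tgt e ≡ tgt f))
                   ⊎ ((src e ≡ tgt f) × (tgt e ≡ src f)) → e ≡ f
open Graph public

Elt : Graph → Set
Elt G = Fin (n G) ⊎ Fin (m G)

deg : (G : Graph) → Fin (n G) → ℕ
deg G v = length (filter (λ e → (v ≟ src G e) ⊎-dec (v ≟ tgt G e)) (allFin (m G)))

Inc : (G : Graph) → Elt G → Elt G → Set
Inc G (inj₁ v) (inj₂ e) = (v ≡ src G e) ⊎ (v ≡ tgt G e)
Inc G (inj₂ e) (inj₁ v) = (v ≡ src G e) ⊎ (v ≡ tgt G e)
Inc G _ _ = ⊥

MixedPath : (G : Graph) → List (Elt G) → Set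
MixedPath G p = Linked (Inc G) p × Unique p

NonRepetitive : {A : Set} → List A → Set
NonRepetitive {A} xs =
  ¬ (Σ (List A) λ as → Σ (List A) λ ys → Σ (List A) λ bs →
       (ys ≢ []) × (xs ≡ as ++ (ys ++ ys) ++ bs))

-- A (partial) coloring of the elements: nothing on deleted elements.
Coloring : Graph → Set
Coloring G = Vec (Maybe ℕ) (n G) × Vec (Maybe ℕ) (m G)

col : (G : Graph) → Coloring G → Elt G → Maybe ℕ
col G (cv , ce) (inj₁ v) = lookup cv v
col G (cv , ce) (inj₂ e) = lookup ce e

-- c ∈ C_L(G ∖ S): a weak total Thue L-coloring of G ∖ S
-- (deleted elements carry the dummy value nothing).
IsColoring : (G : Graph) → (Elt G → List ℕ) → List (Elt G) → Coloring G → Set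
IsColoring G L S c =
    (∀ y → y ∈ S → col G c y ≡ nothing)
  × (∀ y → y ∉ S → ∃[ k ] ((col G c y ≡ just k) × (k ∈ L y)))
  × (∀ p → MixedPath G p → All (_∉ S) p → NonRepetitive (map (col G c) p))

HasSize : {A : Set} → (A → Set) → ℕ → Set
HasSize {A} P k = Σ (List A) λ xs → Unique xs × (length xs ≡ k) × (∀ x → P x ⇔ (x ∈ xs))

-- For a list S of deleted elements write C(S) for the colorings of G ∖ S, and let α(y) be 1.62Δ
-- for a vertex and 4.2Δ for an edge; we show |C(S)| ≥ α(x) |C(x ∷ S)| for all x ∉ S, by induction
-- on the number of undeleted elements. Extending each coloring in C(x ∷ S) by each colour of L(x)
-- gives |L(x)| |C(x ∷ S)| distinct colorings; those outside C(S) have a square on a mixed path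
-- through x, with x in the first half after reversing the path if necessary. Such a coloring is
-- determined by the two walks leaving x that make up the path, the half-length, and its
-- restriction to G ∖ (S ∪ first half), since the first half is copied from the second. By
-- induction each deleted element of the first half divides the count by α, while the walks branch
-- at most Δ-fold at every other step; the resulting geometric series bounds the bad colorings by
-- 2.63Δ |C(x ∷ S)| for a vertex and by 15 |C(x ∷ S)| for an edge, and |L(x)| ≥ 4.25Δ leaves the claim.
-- Sizes of these sets exist only classically, so they are compared under double negation, which
-- is harmless since ≤ on ℕ is decidable.

module Submission where

open import Defs
open import Data.Nat using (ℕ; _≤_; _<_; _*_)
open import Data.List using (List; []; _∷_; length)
open import Data.Sum using (inj₁; inj₂)
open import Data.Product using (_×_)
open import Data.List.Relation.Unary.Unique.Propositional using (Unique)

open import Data.Bool using (Bool; true; false; not)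
open import Data.Bool.Properties using (not-involutive)
open import Data.Empty using (⊥; ⊥-elim)
open import Data.Fin using (Fin) renaming (zero to fzero; suc to fsuc; _≟_ to _≟ᶠ_)
open import Data.List using (_++_; _∷ʳ_; map; reverse; take; drop; zip; concatMap; cartesianProduct; filter; allFin; fromMaybe)
open import Data.List.Properties
open import Data.List.Membership.Propositional using (_∈_; _∉_; find; lose)
open import Data.List.Membership.Propositional.Properties
  using (∈-∃++; ∈-++⁺ˡ; ∈-++⁺ʳ; ∈-++⁻; ∈-map⁺; ∈-map⁻; ∈-allFin; ∈-filter⁺; ∈-filter⁻; ∈-concatMap⁺; ∈-concatMap⁻;
         ∈-cartesianProduct⁺; ∈-cartesianProduct⁻)
import Data.List.Membership.DecPropositional as DecMembership
import Data.List.Relation.Binary.Permutation.Setoid as Perm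
import Data.List.Relation.Binary.Permutation.Setoid.Properties as Perm
open import Data.List.Relation.Binary.Permutation.Propositional.Properties using (↭-reverse)
open import Data.List.Relation.Binary.Subset.Propositional using (_⊆_)
open import Data.List.Relation.Unary.All as All using (All; []; _∷_)
import Data.List.Relation.Unary.All.Properties as All
open import Data.List.Relation.Unary.Any using (here; there)
import Data.List.Relation.Unary.Any.Properties as Any
open import Data.List.Relation.Unary.Linked as Linked using (Linked; []; [-]; _∷_)
open import Data.List.Relation.Unary.Unique.Propositional using ([]; _∷_)
import Data.List.Relation.Unary.Unique.Propositional.Properties as Unique
open import Data.Maybe using (Maybe; just; nothing)
import Data.Maybe.Properties as Maybe
open import Data.Nat using (zero; suc; _+_; _^_; _∸_; _≤?_; _<?_; z≤n; s≤s; NonZero; >-nonZero)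
open import Data.Nat.Induction using (<-wellFounded)
open import Data.Nat.ListAction using (product)
open import Data.Nat.ListAction.Properties using (product-++; product-↭)
open import Data.Nat.Properties
open import Data.Nat.Tactic.RingSolver using (solve-∀)
open import Data.Product using (Σ; ∃; ∃₂; _,_; proj₁; proj₂; map₂)
import Data.Product.Properties as Product
open import Data.Sum using (_⊎_)
import Data.Sum.Properties as Sum
open import Data.Unit using (⊤; tt)
open import Data.Vec using (Vec; lookup; _[_]≔_) renaming ([] to []ᵛ; _∷_ to _∷ᵛ_)
import Data.Vec.Properties as Vec
open import Effect.Monad using (RawMonad)
open import Function using (_∘_)
open import Function.Bundles using (_⇔_; mk⇔; Equivalence)
import Induction.WellFounded as WF
import Level
open import Relation.Binary.Definitions using (DecidableEquality; Symmetric)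
import Relation.Binary.Construct.On as On
open import Relation.Binary.PropositionalEquality
open import Relation.Nullary using (¬_; Dec; yes; no; ¬?)
open import Relation.Nullary.Decidable using (_⊎-dec_; _×-dec_; decidable-stable; toWitness; ¬¬-excluded-middle)
open import Relation.Nullary.Negation using (¬¬-Monad)

open RawMonad (¬¬-Monad {a = Level.zero}) using (pure; _>>=_)

module _ {A : Set} where

  ∈-++-∷⁻ : ∀ xs {x y : A} {ys} → y ∈ xs ++ x ∷ ys → y ≢ x → y ∈ xs ++ ys
  ∈-++-∷⁻ []       (here y≡x) y≢x = ⊥-elim (y≢x y≡x)
  ∈-++-∷⁻ []       (there y∈)  _  = y∈
  ∈-++-∷⁻ (_ ∷ xs) (here y≡z)  _  = here y≡z
  ∈-++-∷⁻ (_ ∷ xs) (there y∈) y≢x = there (∈-++-∷⁻ xs y∈ y≢x)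

  length-≤-⊆ : {xs ys : List A} → Unique xs → xs ⊆ ys → length xs ≤ length ys
  length-≤-⊆ []                  _  = z≤n
  length-≤-⊆ {x ∷ xs} (x∉xs ∷ u) xs⊆ys with ∈-∃++ (xs⊆ys (here refl))
  ... | ys₁ , ys₂ , refl = begin
    suc (length xs)                  ≤⟨ s≤s (length-≤-⊆ u xs⊆ys₁₂) ⟩
    suc (length (ys₁ ++ ys₂))        ≡⟨ cong suc (length-++ ys₁) ⟩
    suc (length ys₁ + length ys₂)    ≡⟨ +-suc (length ys₁) (length ys₂) ⟨
    length ys₁ + length (x ∷ ys₂)    ≡⟨ length-++ ys₁ ⟨
    length (ys₁ ++ x ∷ ys₂)          ∎
    where
    open ≤-Reasoning
    xs⊆ys₁₂ : xs ⊆ ys₁ ++ ys₂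
    xs⊆ys₁₂ y∈xs = ∈-++-∷⁻ ys₁ (xs⊆ys (there y∈xs)) (λ y≡x → All.lookup x∉xs y∈xs (sym y≡x))

  Unique-++⁻ˡ : ∀ xs {ys : List A} → Unique (xs ++ ys) → Unique xs
  Unique-++⁻ˡ []       _       = []
  Unique-++⁻ˡ (x ∷ xs) (p ∷ u) = All.++⁻ˡ xs p ∷ Unique-++⁻ˡ xs u

  Unique-++⁻ʳ : ∀ xs {ys : List A} → Unique (xs ++ ys) → Unique ys
  Unique-++⁻ʳ []       u       = u
  Unique-++⁻ʳ (x ∷ xs) (_ ∷ u) = Unique-++⁻ʳ xs u

  Unique-++-disjoint : ∀ xs {ys : List A} {y} → Unique (xs ++ ys) → y ∈ xs → y ∉ ys
  Unique-++-disjoint (x ∷ xs) (p ∷ _) (here refl) y∈ys = All.lookup p (∈-++⁺ʳ xs y∈ys) refl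
  Unique-++-disjoint (x ∷ xs) (_ ∷ u) (there y∈xs)    = Unique-++-disjoint xs u y∈xs

  Unique-++-∷⁻ : ∀ xs {x : A} {ys} → Unique (xs ++ x ∷ ys) → Unique (xs ++ ys)
  Unique-++-∷⁻ []       (_ ∷ u) = u
  Unique-++-∷⁻ (z ∷ xs) (p ∷ u) =
    All.anti-mono (λ {y} y∈ → ∈-++⁺-∷ y∈) p ∷ Unique-++-∷⁻ xs u
    where
    ∈-++⁺-∷ : ∀ {x y : A} {ys} → y ∈ xs ++ ys → y ∈ xs ++ x ∷ ys
    ∈-++⁺-∷ y∈ with ∈-++⁻ xs y∈
    ... | inj₁ y∈xs = ∈-++⁺ˡ y∈xs
    ... | inj₂ y∈ys = ∈-++⁺ʳ xs (there y∈ys)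

  Unique-++-∷⇒∉ : ∀ xs {x : A} {ys} → Unique (xs ++ x ∷ ys) → x ∉ xs ++ ys
  Unique-++-∷⇒∉ []       (p ∷ _) x∈ys        = All.lookup p x∈ys refl
  Unique-++-∷⇒∉ (z ∷ xs) (p ∷ _) (here refl) = All.lookup p (∈-++⁺ʳ xs (here refl)) refl
  Unique-++-∷⇒∉ (z ∷ xs) (_ ∷ u) (there x∈)  = Unique-++-∷⇒∉ xs u x∈

  Unique-reverse⁺ : ∀ xs → Unique {A = A} xs → Unique (reverse xs)
  Unique-reverse⁺ xs = Perm.Unique-resp-↭ (setoid A) (Perm.↭-sym (setoid A) (Perm.↭-reverse (setoid A) xs))

  ++-injective : ∀ (xs ys : List A) {xs′ ys′} → length xs ≡ length ys →
                 xs ++ xs′ ≡ ys ++ ys′ → xs ≡ ys × xs′ ≡ ys′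
  ++-injective []       []       _   eq = refl , eq
  ++-injective (x ∷ xs) (y ∷ ys) len eq =
    let xs≡ys , xs′≡ys′ = ++-injective xs ys (suc-injective len) (∷-injectiveʳ eq)
    in cong₂ _∷_ (∷-injectiveˡ eq) xs≡ys , xs′≡ys′

module _ {A : Set} {R : A → A → Set} where

  Linked-++⁻ˡ : ∀ xs {ys} → Linked R (xs ++ ys) → Linked R xs
  Linked-++⁻ˡ []           _         = []
  Linked-++⁻ˡ (x ∷ [])     _         = [-]
  Linked-++⁻ˡ (x ∷ y ∷ xs) (r ∷ rs) = r ∷ Linked-++⁻ˡ (y ∷ xs) rs

  Linked-++⁻ʳ : ∀ xs {ys} → Linked R (xs ++ ys) → Linked R ys
  Linked-++⁻ʳ []       rs = rs
  Linked-++⁻ʳ (x ∷ xs) rs = Linked-++⁻ʳ xs (Linked.tail rs)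

  Linked-∷ʳ : ∀ xs {y z} → Linked R (xs ∷ʳ y) → R y z → Linked R (xs ∷ʳ y ∷ʳ z)
  Linked-∷ʳ []           _        r = r ∷ [-]
  Linked-∷ʳ (x ∷ [])     (r′ ∷ _) r = r′ ∷ r ∷ [-]
  Linked-∷ʳ (x ∷ w ∷ xs) (r′ ∷ rs) r = r′ ∷ Linked-∷ʳ (w ∷ xs) rs r

  Linked-reverse⁺ : Symmetric R → ∀ xs → Linked R xs → Linked R (reverse xs)
  Linked-reverse⁺ sym-R []           _        = []
  Linked-reverse⁺ sym-R (x ∷ [])     _        = [-]
  Linked-reverse⁺ sym-R (x ∷ y ∷ xs) (r ∷ rs) =
    subst (Linked R) (sym reverse-xyxs) (Linked-∷ʳ (reverse xs) reverse-yxs (sym-R r))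
    where
    reverse-yxs : Linked R (reverse xs ∷ʳ y)
    reverse-yxs = subst (Linked R) (unfold-reverse y xs) (Linked-reverse⁺ sym-R (y ∷ xs) rs)
    reverse-xyxs : reverse (x ∷ y ∷ xs) ≡ reverse xs ∷ʳ y ∷ʳ x
    reverse-xyxs = trans (unfold-reverse x (y ∷ xs)) (cong (_∷ʳ x) (unfold-reverse y xs))

module _ {A B : Set} (f : A → B) where

  map-≡-++ : ∀ xs ys zs → map f xs ≡ ys ++ zs →
             Σ (List A) λ xs₁ → Σ (List A) λ xs₂ → xs ≡ xs₁ ++ xs₂ × map f xs₁ ≡ ys × map f xs₂ ≡ zs
  map-≡-++ xs       []       zs eq = [] , xs , refl , refl , eq
  map-≡-++ (x ∷ xs) (y ∷ ys) zs eq with map-≡-++ xs ys zs (∷-injectiveʳ eq)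
  ... | xs₁ , xs₂ , refl , eq₁ , eq₂ = x ∷ xs₁ , xs₂ , refl , cong₂ _∷_ (∷-injectiveˡ eq) eq₁ , eq₂

  Unique-map⁺-∈ : ∀ {xs} → (∀ {a b} → a ∈ xs → b ∈ xs → f a ≡ f b → a ≡ b) → Unique xs → Unique (map f xs)
  Unique-map⁺-∈ {[]}     _   []      = []
  Unique-map⁺-∈ {x ∷ xs} inj (p ∷ u) =
    All.map⁺ (All.tabulate λ {y} y∈xs fx≡fy → All.lookup p y∈xs (inj (here refl) (there y∈xs) fx≡fy))
    ∷ Unique-map⁺-∈ (λ a∈ b∈ → inj (there a∈) (there b∈)) u

module _ {A B : Set} where

  length-concatMap-*-≤ : ∀ (g : A → List B) xs w c → (∀ {z} → z ∈ xs → length (g z) * w ≤ c) →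
                         length (concatMap g xs) * w ≤ length xs * c
  length-concatMap-*-≤ g []       w c bound = z≤n
  length-concatMap-*-≤ g (x ∷ xs) w c bound = begin
    length (g x ++ concatMap g xs) * w                  ≡⟨ cong (_* w) (length-++ (g x)) ⟩
    (length (g x) + length (concatMap g xs)) * w        ≡⟨ *-distribʳ-+ w (length (g x)) _ ⟩
    length (g x) * w + length (concatMap g xs) * w      ≤⟨ +-mono-≤ (bound (here refl)) (length-concatMap-*-≤ g xs w c (bound ∘ there)) ⟩
    c + length xs * c                                   ∎
    where open ≤-Reasoning

  length-concatMap-≤ : ∀ (f : A → List B) xs c → (∀ {z} → z ∈ xs → length (f z) ≤ c) →
                       length (concatMap f xs) ≤ length xs * c
  length-concatMap-≤ f []       c bound = z≤n
  length-concatMap-≤ f (x ∷ xs) c bound = begin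
    length (f x ++ concatMap f xs)          ≡⟨ length-++ (f x) ⟩
    length (f x) + length (concatMap f xs)  ≤⟨ +-mono-≤ (bound (here refl)) (length-concatMap-≤ f xs c (bound ∘ there)) ⟩
    c + length xs * c                       ∎
    where
    open ≤-Reasoning

product-map-reverse : ∀ {A : Set} (f : A → ℕ) xs → product (map f (reverse xs)) ≡ product (map f xs)
product-map-reverse f xs = trans (cong product (reverse-map f xs)) (product-↭ (↭-reverse (map f xs)))

length-cartesianProduct : ∀ {A B : Set} (xs : List A) (ys : List B) →
                          length (cartesianProduct xs ys) ≡ length xs * length ys
length-cartesianProduct []       ys = refl
length-cartesianProduct (x ∷ xs) ys =
  trans (length-++ (map (x ,_) ys)) (cong₂ _+_ (length-map _ ys) (length-cartesianProduct xs ys))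

module _ {A : Set} where

  map-proj₁-zip : ∀ (xs ys : List A) → length xs ≡ length ys → map proj₁ (zip xs ys) ≡ xs
  map-proj₁-zip []       []       _   = refl
  map-proj₁-zip (x ∷ xs) (y ∷ ys) len = cong (x ∷_) (map-proj₁-zip xs ys (suc-injective len))

  ∈-zip⁺ˡ : ∀ (xs ys : List A) {y} → length xs ≡ length ys → y ∈ xs → ∃ λ y′ → (y , y′) ∈ zip xs ys
  ∈-zip⁺ˡ (x ∷ xs) (y′ ∷ ys) _   (here refl) = y′ , here refl
  ∈-zip⁺ˡ (x ∷ xs) (_ ∷ ys)  len (there y∈)  = let y′ , p = ∈-zip⁺ˡ xs ys (suc-injective len) y∈ in y′ , there p

  ∈-zip⁻ʳ : ∀ (xs ys : List A) {y y′} → (y , y′) ∈ zip xs ys → y′ ∈ ys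
  ∈-zip⁻ʳ (x ∷ xs) (_ ∷ ys) (here refl) = here refl
  ∈-zip⁻ʳ (x ∷ xs) (_ ∷ ys) (there p)   = there (∈-zip⁻ʳ xs ys p)

  map-≡-zip : ∀ {B : Set} (f : A → B) (xs ys : List A) {y y′} → map f xs ≡ map f ys → (y , y′) ∈ zip xs ys → f y ≡ f y′
  map-≡-zip f (x ∷ xs) (_ ∷ ys) eq (here refl) = ∷-injectiveˡ eq
  map-≡-zip f (x ∷ xs) (_ ∷ ys) eq (there p)   = map-≡-zip f xs ys (∷-injectiveʳ eq) p

module _ {A : Set} where

  vectors : ∀ k → (Fin k → List A) → List (Vec A k)
  vectors zero    opts = []ᵛ ∷ []
  vectors (suc k) opts = concatMap (λ a → map (a ∷ᵛ_) (vectors k (λ i → opts (fsuc i)))) (opts fzero)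

  ∈-vectors : ∀ k opts (v : Vec A k) → (∀ i → lookup v i ∈ opts i) → v ∈ vectors k opts
  ∈-vectors zero    opts []ᵛ       _      = here refl
  ∈-vectors (suc k) opts (a ∷ᵛ v) a∷v∈ =
    ∈-concatMap⁺ (λ a → map (a ∷ᵛ_) (vectors k (λ i → opts (fsuc i))))
      (lose (a∷v∈ fzero) (∈-map⁺ (a ∷ᵛ_) (∈-vectors k _ v (λ i → a∷v∈ (fsuc i)))))

  Vec-ext : ∀ {k} (u v : Vec A k) → (∀ i → lookup u i ≡ lookup v i) → u ≡ v
  Vec-ext u v u≗v = trans (sym (Vec.tabulate∘lookup u)) (trans (Vec.tabulate-cong u≗v) (Vec.tabulate∘lookup v))

-- Enumerations and double negation

module _ {A : Set} where

  IsEnumeration : (A → Set) → List A → Set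
  IsEnumeration P xs = Unique xs × (∀ x → P x ⇔ x ∈ xs)

  IsEnumeration⇒HasSize : ∀ {P : A → Set} {xs} → IsEnumeration P xs → HasSize P (length xs)
  IsEnumeration⇒HasSize {xs = xs} (u , eq) = xs , u , refl , eq

  HasSize-mono : ∀ {P Q : A → Set} {a b} → HasSize P a → HasSize Q b → (∀ x → P x → Q x) → a ≤ b
  HasSize-mono (xs , u , refl , P⇔) (ys , _ , refl , Q⇔) P⇒Q =
    length-≤-⊆ u λ {x} x∈xs → Equivalence.to (Q⇔ x) (P⇒Q x (Equivalence.from (P⇔ x) x∈xs))

module _ {A : Set} (_≟_ : DecidableEquality A) {P : A → Set} where

  open DecMembership _≟_ using (_∈?_)

  private
    insert-candidate : ∀ c {C} → Dec (P c) → Σ (List A) (IsEnumeration (λ x → P x × x ∈ C)) →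
                       Σ (List A) (IsEnumeration (λ x → P x × x ∈ c ∷ C))
    insert-candidate c (no ¬pc) (xs , u , eq) = xs , u , λ x → mk⇔
      (λ { (px , here refl) → ⊥-elim (¬pc px) ; (px , there x∈C) → Equivalence.to (eq x) (px , x∈C) })
      (λ x∈xs → map₂ there (Equivalence.from (eq x) x∈xs))
    insert-candidate c (yes pc) (xs , u , eq) with c ∈? xs
    ... | yes c∈xs = xs , u , λ x → mk⇔
      (λ { (px , here refl) → c∈xs ; (px , there x∈C) → Equivalence.to (eq x) (px , x∈C) })
      (λ x∈xs → map₂ there (Equivalence.from (eq x) x∈xs))
    ... | no c∉xs = c ∷ xs , All.tabulate (λ x∈xs c≡x → c∉xs (subst (_∈ xs) (sym c≡x) x∈xs)) ∷ u , λ x → mk⇔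
      (λ { (px , here refl) → here refl ; (px , there x∈C) → there (Equivalence.to (eq x) (px , x∈C)) })
      (λ { (here refl) → pc , here refl ; (there x∈xs) → map₂ there (Equivalence.from (eq x) x∈xs) })

    ¬¬-enumeration-within : ∀ C → ¬ ¬ Σ (List A) (IsEnumeration (λ x → P x × x ∈ C))
    ¬¬-enumeration-within []      = pure ([] , [] , λ x → mk⇔ (λ ()) (λ ()))
    ¬¬-enumeration-within (c ∷ C) = do
      enum ← ¬¬-enumeration-within C
      pc? ← ¬¬-excluded-middle
      pure (insert-candidate c pc? enum)

  ¬¬-enumeration : (C : List A) → (∀ x → P x → x ∈ C) → ¬ ¬ Σ (List A) (IsEnumeration P)
  ¬¬-enumeration C P⊆C = do
    xs , u , eq ← ¬¬-enumeration-within C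
    pure (xs , u , λ x → mk⇔ (λ px → Equivalence.to (eq x) (px , P⊆C x px))
                             (λ x∈xs → proj₁ (Equivalence.from (eq x) x∈xs)))

module _ {I C : Set} (_≟_ : DecidableEquality I) (default : C) {P : I → C → Set} where

  ¬¬-choice : ∀ is → (∀ i → ¬ ¬ Σ C (P i)) → ¬ ¬ Σ (I → C) λ g → ∀ {i} → i ∈ is → P i (g i)
  ¬¬-choice []        _ = pure ((λ _ → default) , λ ())
  ¬¬-choice (i₀ ∷ is) h = do
    c₀ , p₀ ← h i₀
    g , g-spec ← ¬¬-choice is h
    let g′ : I → C
        g′ i = pick (i ≟ i₀) (g i) c₀
    pure (g′ , λ { (here refl) → pick-spec (i₀ ≟ i₀) p₀ (λ i₀≢i₀ → ⊥-elim (i₀≢i₀ refl))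
                 ; (there i∈) → pick-spec (_ ≟ i₀) p₀ (λ _ → g-spec i∈) })
    where
    pick : ∀ {i} → Dec (i ≡ i₀) → C → C → C
    pick (yes _) _ c₀ = c₀
    pick (no _)  c _  = c
    pick-spec : ∀ {i c c₀} (i≟i₀ : Dec (i ≡ i₀)) → P i₀ c₀ → (i ≢ i₀ → P i c) → P i (pick i≟i₀ c c₀)
    pick-spec (yes refl) p₀ _ = p₀
    pick-spec (no i≢i₀)  _  p = p i≢i₀

-- Sums and geometric series

Σ< : ℕ → (ℕ → ℕ) → ℕ
Σ< zero    f = 0
Σ< (suc n) f = Σ< n f + f n

Σ<-cong : ∀ n {f g : ℕ → ℕ} → (∀ i → f i ≡ g i) → Σ< n f ≡ Σ< n g
Σ<-cong zero    f≗g = refl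
Σ<-cong (suc n) f≗g = cong₂ _+_ (Σ<-cong n f≗g) (f≗g n)

Σ<-*ˡ : ∀ n c (f : ℕ → ℕ) → c * Σ< n f ≡ Σ< n (λ i → c * f i)
Σ<-*ˡ zero    c f = *-zeroʳ c
Σ<-*ˡ (suc n) c f = trans (*-distribˡ-+ c (Σ< n f) (f n)) (cong (_+ c * f n) (Σ<-*ˡ n c f))

Σ<-*ʳ : ∀ n c (f : ℕ → ℕ) → Σ< n f * c ≡ Σ< n (λ i → f i * c)
Σ<-*ʳ n c f = trans (*-comm (Σ< n f) c) (trans (Σ<-*ˡ n c f) (Σ<-cong n (λ i → *-comm c (f i))))

Σ<-pairs : ∀ n (f : ℕ → ℕ) → Σ< (n + n) f ≡ Σ< n (λ t → f (t + t) + f (suc (t + t)))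
Σ<-pairs zero    f = refl
Σ<-pairs (suc n) f = begin
  Σ< (suc n + suc n) f                         ≡⟨ cong (λ m → Σ< (suc m) f) (+-suc n n) ⟩
  Σ< (n + n) f + f (n + n) + f (suc (n + n))   ≡⟨ +-assoc (Σ< (n + n) f) _ _ ⟩
  Σ< (n + n) f + (f (n + n) + f (suc (n + n))) ≡⟨ cong (_+ (f (n + n) + f (suc (n + n)))) (Σ<-pairs n f) ⟩
  Σ< n (λ t → f (t + t) + f (suc (t + t))) + (f (n + n) + f (suc (n + n))) ∎
  where open ≡-Reasoning

-- The invariant  r qᵀ Σ<ᵀ Y + q K pᵀ ≤ q K qᵀ  is preserved by each step, since Yₜ qᵗ ≤ K pᵗ and p + r = q.
Σ<-geometric-invariant : ∀ p r K (Y : ℕ → ℕ) T → (∀ t → t < T → Y t * (p + r) ^ t ≤ K * p ^ t) →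
                         r * (p + r) ^ T * Σ< T Y + (p + r) * K * p ^ T ≤ (p + r) * K * (p + r) ^ T
Σ<-geometric-invariant p r K Y zero    _     = ≤-reflexive (lemma r (p + r) K)
  where
  lemma : ∀ r q K → r * 1 * 0 + q * K * 1 ≡ q * K * 1
  lemma = solve-∀
Σ<-geometric-invariant p r K Y (suc T) bound = begin
  r * q ^ suc T * (Σ< T Y + Y T) + q * K * p ^ suc T
    ≡⟨ expand r p K (Σ< T Y) (Y T) (q ^ T) (p ^ T) ⟩
  q * (r * q ^ T * Σ< T Y) + r * q * (Y T * q ^ T) + q * p * (K * p ^ T)
    ≤⟨ +-monoˡ-≤ _ (+-monoʳ-≤ (q * (r * q ^ T * Σ< T Y)) (*-monoʳ-≤ (r * q) (bound T ≤-refl))) ⟩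
  q * (r * q ^ T * Σ< T Y) + r * q * (K * p ^ T) + q * p * (K * p ^ T)
    ≡⟨ collect r p K (r * q ^ T * Σ< T Y) (p ^ T) ⟩
  q * (r * q ^ T * Σ< T Y + q * K * p ^ T)
    ≤⟨ *-monoʳ-≤ q (Σ<-geometric-invariant p r K Y T (λ t t<T → bound t (m≤n⇒m≤1+n t<T))) ⟩
  q * (q * K * q ^ T)
    ≡⟨ rotate q K (q ^ T) ⟩
  q * K * q ^ suc T ∎
  where
  open ≤-Reasoning
  q = p + r
  expand : ∀ r p K S y Q P → r * ((p + r) * Q) * (S + y) + (p + r) * K * (p * P)
           ≡ (p + r) * (r * Q * S) + r * (p + r) * (y * Q) + (p + r) * p * (K * P)
  expand = solve-∀
  collect : ∀ r p K A P → (p + r) * A + r * (p + r) * (K * P) + (p + r) * p * (K * P)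
            ≡ (p + r) * (A + (p + r) * K * P)
  collect = solve-∀
  rotate : ∀ q K Q → q * (q * K * Q) ≡ q * K * (q * Q)
  rotate = solve-∀

Σ<-geometric : ∀ {p r} q ⦃ _ : NonZero q ⦄ → p + r ≡ q → ∀ T (Y : ℕ → ℕ) K →
               (∀ t → t < T → Y t * q ^ t ≤ K * p ^ t) → r * Σ< T Y ≤ q * K
Σ<-geometric {p} {r} q refl T Y K bound =
  *-cancelʳ-≤ (r * Σ< T Y) (q * K) (q ^ T) ⦃ m^n≢0 q T ⦄ (begin
    r * Σ< T Y * q ^ T                 ≡⟨ swap r (Σ< T Y) (q ^ T) ⟩
    r * q ^ T * Σ< T Y                 ≤⟨ m≤m+n _ _ ⟩
    r * q ^ T * Σ< T Y + q * K * p ^ T ≤⟨ Σ<-geometric-invariant p r K Y T bound ⟩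
    q * K * q ^ T                      ∎)
  where
  open ≤-Reasoning
  swap : ∀ a b c → a * b * c ≡ a * c * b
  swap = solve-∀

alternating : ℕ → ℕ → ℕ → ℕ
alternating a b zero    = 1
alternating a b (suc i) = a * alternating b a i

alternating-even : ∀ a b t → alternating a b (t + t) ≡ (a * b) ^ t
alternating-even a b zero    = refl
alternating-even a b (suc t) = begin
  alternating a b (suc t + suc t)           ≡⟨ cong (λ m → alternating a b (suc m)) (+-suc t t) ⟩
  a * (b * alternating a b (t + t))         ≡⟨ *-assoc a b _ ⟨
  a * b * alternating a b (t + t)           ≡⟨ cong (a * b *_) (alternating-even a b t) ⟩
  (a * b) ^ suc t                           ∎
  where open ≡-Reasoning

alternating-odd : ∀ a b t → alternating a b (suc (t + t)) ≡ a * (a * b) ^ t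
alternating-odd a b t = cong (a *_) (trans (alternating-even b a t) (cong (_^ t) (*-comm b a)))

-- Grouping the terms in pairs (2t, 2t + 1) gives a geometric series of ratio (c d)/(a b),
-- the pair t contributing at most ((a + c)/a) K (c d / a b)ᵗ.
Σ<-alternating : ∀ {a b c d r} ⦃ _ : NonZero (a * b) ⦄ → c * d + r ≡ a * b → ∀ N (Y : ℕ → ℕ) K →
                 (∀ i → i < N + N → Y i * alternating a b i ≤ K * alternating c d i) →
                 r * a * Σ< (N + N) Y ≤ a * b * (a + c) * K
Σ<-alternating {a} {b} {c} {d} {r} cd+r≡ab N Y K bound = begin
  r * a * Σ< (N + N) Y                             ≡⟨ cong (r * a *_) (Σ<-pairs N Y) ⟩
  r * a * Σ< N Pair                                ≡⟨ *-assoc r a _ ⟩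
  r * (a * Σ< N Pair)                              ≡⟨ cong (r *_) (Σ<-*ˡ N a Pair) ⟩
  r * Σ< N (λ t → a * Pair t)                      ≤⟨ Σ<-geometric (a * b) cd+r≡ab N _ ((a + c) * K) pair-bound ⟩
  a * b * ((a + c) * K)                            ≡⟨ *-assoc (a * b) (a + c) K ⟨
  a * b * (a + c) * K                              ∎
  where
  open ≤-Reasoning
  Pair : ℕ → ℕ
  Pair t = Y (t + t) + Y (suc (t + t))
  pair-bound : ∀ t → t < N → a * Pair t * (a * b) ^ t ≤ (a + c) * K * (c * d) ^ t
  pair-bound t t<N = begin
    a * Pair t * (a * b) ^ t
      ≡⟨ split a (Y (t + t)) (Y (suc (t + t))) ((a * b) ^ t) ⟩
    a * (Y (t + t) * (a * b) ^ t) + Y (suc (t + t)) * (a * (a * b) ^ t)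
      ≡⟨ cong₂ (λ u v → a * (Y (t + t) * u) + Y (suc (t + t)) * v) (alternating-even a b t) (alternating-odd a b t) ⟨
    a * (Y (t + t) * alternating a b (t + t)) + Y (suc (t + t)) * alternating a b (suc (t + t))
      ≤⟨ +-mono-≤ (*-monoʳ-≤ a (bound (t + t) (<⇒≤ 2t+1<N+N))) (bound (suc (t + t)) 2t+1<N+N) ⟩
    a * (K * alternating c d (t + t)) + K * alternating c d (suc (t + t))
      ≡⟨ cong₂ (λ u v → a * (K * u) + K * v) (alternating-even c d t) (alternating-odd c d t) ⟩
    a * (K * (c * d) ^ t) + K * (c * (c * d) ^ t)
      ≡⟨ merge a c K ((c * d) ^ t) ⟩
    (a + c) * K * (c * d) ^ t ∎
    where
    2t+1<N+N : suc (t + t) < N + N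
    2t+1<N+N = ≤-trans (≤-reflexive (cong suc (sym (+-suc t t)))) (+-mono-≤ t<N t<N)
    split : ∀ a y z P → a * (y + z) * P ≡ a * (y * P) + z * (a * P)
    split = solve-∀
    merge : ∀ a c K P → a * (K * P) + K * (c * P) ≡ (a + c) * K * P
    merge = solve-∀

Σ<²-alternating : ∀ {a b c d r} ⦃ _ : NonZero (a * b) ⦄ → c * d + r ≡ a * b → ∀ N (X : ℕ → ℕ → ℕ) K →
                  (∀ l m → l < N + N → m < N + N →
                     X l m * alternating a b l * alternating a b m ≤ K * alternating c d l * alternating c d m) →
                  r * a * (r * a) * Σ< (N + N) (λ l → Σ< (N + N) (X l)) ≤ a * b * (a + c) * (a * b * (a + c)) * K
Σ<²-alternating {a} {b} {c} {d} {r} cd+r≡ab N X K bound = begin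
  r * a * (r * a) * Σ< (N + N) (λ l → Σ< (N + N) (X l))   ≡⟨ *-assoc (r * a) (r * a) _ ⟩
  r * a * (r * a * Σ< (N + N) (λ l → Σ< (N + N) (X l)))   ≡⟨ cong (r * a *_) (Σ<-*ˡ (N + N) (r * a) _) ⟩
  r * a * Σ< (N + N) Row                                  ≤⟨ Σ<-alternating cd+r≡ab N Row (C * K) row-bound ⟩
  C * (C * K)                                 ≡⟨ *-assoc C C K ⟨
  C * C * K                                   ∎
  where
  open ≤-Reasoning
  C = a * b * (a + c)
  Row : ℕ → ℕ
  Row l = r * a * Σ< (N + N) (X l)
  row-bound : ∀ l → l < N + N → Row l * alternating a b l ≤ C * K * alternating c d l
  row-bound l l< = begin
    r * a * Σ< (N + N) (X l) * alternating a b l          ≡⟨ *-assoc (r * a) _ _ ⟩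
    r * a * (Σ< (N + N) (X l) * alternating a b l)        ≡⟨ cong (r * a *_) (Σ<-*ʳ (N + N) _ (X l)) ⟩
    r * a * Σ< (N + N) (λ m → X l m * alternating a b l)  ≤⟨ Σ<-alternating cd+r≡ab N _ (K * alternating c d l) (λ m m< → bound l m l< m<) ⟩
    C * (K * alternating c d l)                     ≡⟨ *-assoc C K _ ⟨
    C * K * alternating c d l                       ∎

module _ {A : Set} where

  concat< : ℕ → (ℕ → List A) → List A
  concat< zero    f = []
  concat< (suc n) f = concat< n f ++ f n

  length-concat< : ∀ n (f : ℕ → List A) → length (concat< n f) ≡ Σ< n (λ i → length (f i))
  length-concat< zero    f = refl
  length-concat< (suc n) f = trans (length-++ (concat< n f)) (cong (_+ length (f n)) (length-concat< n f))

  ∈-concat< : ∀ n (f : ℕ → List A) {i y} → i < n → y ∈ f i → y ∈ concat< n f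
  ∈-concat< (suc n) f {i} i<1+n y∈ with i ≟ n
  ... | yes refl = ∈-++⁺ʳ (concat< n f) y∈
  ... | no  i≢n  = ∈-++⁺ˡ (∈-concat< n f (≤∧≢⇒< (≤-pred i<1+n) i≢n) y∈)

-- Mixed walks

module Walks (G : Graph) where

  _≟ᴱ_ : DecidableEquality (Elt G)
  _≟ᴱ_ = Sum.≡-dec _≟ᶠ_ _≟ᶠ_

  open DecMembership _≟ᴱ_ public using (_∈?_)

  elements : List (Elt G)
  elements = map inj₁ (allFin (n G)) ++ map inj₂ (allFin (m G))

  ∈-elements : ∀ y → y ∈ elements
  ∈-elements (inj₁ v) = ∈-++⁺ˡ (∈-map⁺ inj₁ (∈-allFin v))
  ∈-elements (inj₂ e) = ∈-++⁺ʳ _ (∈-map⁺ inj₂ (∈-allFin e))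

  Inc-sym : Symmetric (Inc G)
  Inc-sym {inj₁ v} {inj₂ e} p = p
  Inc-sym {inj₂ e} {inj₁ v} p = p

  MixedPath-reverse : ∀ {p} → MixedPath G p → MixedPath G (reverse p)
  MixedPath-reverse {p} (linked , unique) = Linked-reverse⁺ Inc-sym p linked , Unique-reverse⁺ p unique

  incidentEdges : Fin (n G) → List (Fin (m G))
  incidentEdges v = filter (λ e → (v ≟ᶠ src G e) ⊎-dec (v ≟ᶠ tgt G e)) (allFin (m G))

  otherEnd : Fin (n G) → Fin (m G) → Fin (n G)
  otherEnd u e with u ≟ᶠ src G e
  ... | yes _ = tgt G e
  ... | no  _ = src G e

  successors : Maybe (Elt G) → Elt G → List (Elt G)
  successors _                (inj₁ v) = map inj₂ (incidentEdges v)
  successors nothing          (inj₂ e) = inj₁ (src G e) ∷ inj₁ (tgt G e) ∷ []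
  successors (just (inj₁ u))  (inj₂ e) = inj₁ (otherEnd u e) ∷ []
  successors (just (inj₂ _))  (inj₂ e) = []

  -- These over-approximate the continuations of y in mixed paths: only stepping back is excluded.
  walks : Maybe (Elt G) → Elt G → ℕ → List (List (Elt G))
  walks p y zero    = [] ∷ []
  walks p y (suc ℓ) = concatMap (λ z → map (z ∷_) (walks (just y) z ℓ)) (successors p y)

  ∈-walks-∷⁻ : ∀ {p y ℓ w} → w ∈ walks p y (suc ℓ) →
               ∃₂ λ z w′ → z ∈ successors p y × w′ ∈ walks (just y) z ℓ × w ≡ z ∷ w′
  ∈-walks-∷⁻ {p} {y} {ℓ} w∈
    with find (∈-concatMap⁻ (λ z → map (z ∷_) (walks (just y) z ℓ)) {successors p y} w∈)
  ... | z , z∈ , w∈zws with ∈-map⁻ (z ∷_) w∈zws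
  ... | w′ , w′∈ , refl = z , w′ , z∈ , w′∈ , refl

  length-walks : ∀ {p y ℓ w} → w ∈ walks p y ℓ → length w ≡ ℓ
  length-walks {ℓ = zero}  (here refl) = refl
  length-walks {p} {y} {suc ℓ} w∈ with ∈-walks-∷⁻ {p} {y} {ℓ} w∈
  ... | _ , _ , _ , w′∈ , refl = cong suc (length-walks {just y} {_} {ℓ} w′∈)

  IncidentFrom : Maybe (Elt G) → Elt G → Set
  IncidentFrom nothing  y = ⊤
  IncidentFrom (just p) y = Inc G p y

  ∈-successors : ∀ p y z → IncidentFrom p y → Inc G y z → z ∉ fromMaybe p → z ∈ successors p y
  ∈-successors p (inj₁ v) (inj₂ e) _ v~e _ =
    ∈-map⁺ inj₂ (∈-filter⁺ (λ e → (v ≟ᶠ src G e) ⊎-dec (v ≟ᶠ tgt G e)) (∈-allFin e) v~e)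
  ∈-successors nothing (inj₂ e) (inj₁ u) _ (inj₁ refl) _ = here refl
  ∈-successors nothing (inj₂ e) (inj₁ u) _ (inj₂ refl) _ = there (here refl)
  ∈-successors (just (inj₁ w)) (inj₂ e) (inj₁ u) w~e u~e u∉ with w ≟ᶠ src G e | w~e | u~e
  ... | yes refl | _          | inj₁ refl = ⊥-elim (u∉ (here refl))
  ... | yes refl | _          | inj₂ refl = here refl
  ... | no  _    | _          | inj₁ refl = here refl
  ... | no  w≢s  | inj₁ w≡s   | inj₂ refl = ⊥-elim (w≢s w≡s)
  ... | no  _    | inj₂ refl  | inj₂ refl = ⊥-elim (u∉ (here refl))

  ∈-walks : ∀ p y w → IncidentFrom p y → Linked (Inc G) (y ∷ w) → Unique (fromMaybe p ++ y ∷ w) →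
            w ∈ walks p y (length w)
  ∈-walks p y []      _ _ _ = here refl
  ∈-walks p y (z ∷ w) p~y linked unique =
    ∈-concatMap⁺ (λ z → map (z ∷_) (walks (just y) z (length w)))
      (lose (∈-successors p y z p~y (Linked.head linked) (z∉p p unique))
            (∈-map⁺ (z ∷_) (∈-walks (just y) z w (Linked.head linked) (Linked.tail linked)
                                     (Unique-++⁻ʳ (fromMaybe p) unique))))
    where
    z∉p : ∀ p → Unique (fromMaybe p ++ y ∷ z ∷ w) → z ∉ fromMaybe p
    z∉p nothing  _                     ()
    z∉p (just _) ((_ ∷ p≢z ∷ _) ∷ _) (here z≡p) = p≢z (sym z≡p)

  isVertex : Elt G → Bool
  isVertex (inj₁ _) = true
  isVertex (inj₂ _) = false

  Alternating : Bool → List (Elt G) → Set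
  Alternating b []      = ⊤
  Alternating b (z ∷ w) = isVertex z ≡ b × Alternating (not b) w

  isVertex-successors : ∀ p y {z} → z ∈ successors p y → isVertex z ≡ not (isVertex y)
  isVertex-successors p (inj₁ v) z∈ with ∈-map⁻ inj₂ z∈
  ... | _ , _ , refl = refl
  isVertex-successors nothing          (inj₂ e) (here refl)         = refl
  isVertex-successors nothing          (inj₂ e) (there (here refl)) = refl
  isVertex-successors (just (inj₁ _))  (inj₂ e) (here refl)         = refl

  walks-alternate : ∀ {p y ℓ w} → w ∈ walks p y ℓ → Alternating (not (isVertex y)) w
  walks-alternate {ℓ = zero}  (here refl) = tt
  walks-alternate {p} {y} {suc ℓ} w∈ with ∈-walks-∷⁻ {p} {y} {ℓ} w∈
  ... | z , w′ , z∈ , w′∈ , refl =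
    z-type , subst (λ b → Alternating (not b) w′) z-type (walks-alternate {just y} {z} {ℓ} w′∈)
    where z-type = isVertex-successors p y z∈

module WalkCount (G : Graph) (Δ : ℕ) (deg<Δ : ∀ v → deg G v < Δ) where

  open Walks G

  -- Leaving a vertex there are fewer than Δ choices; leaving an edge the next vertex is
  -- forced, except at the start, where either endpoint may follow.
  #fromVertex #fromEdge #fromEdge₀ : ℕ → ℕ
  #fromVertex zero    = 1
  #fromVertex (suc ℓ) = Δ * #fromEdge ℓ
  #fromEdge zero      = 1
  #fromEdge (suc ℓ)   = #fromVertex ℓ
  #fromEdge₀ zero     = 1
  #fromEdge₀ (suc ℓ)  = 2 * #fromVertex ℓ

  #walks : Maybe (Elt G) → Elt G → ℕ → ℕ
  #walks _        (inj₁ _) = #fromVertex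
  #walks nothing  (inj₂ _) = #fromEdge₀
  #walks (just _) (inj₂ _) = #fromEdge

  length-walks-≤ : ∀ p y ℓ → length (walks p y ℓ) ≤ #walks p y ℓ
  length-walks-suc-≤ : ∀ p y ℓ {c} → (∀ {z} → z ∈ successors p y → #walks (just y) z ℓ ≤ c) →
                       length (walks p y (suc ℓ)) ≤ length (successors p y) * c

  length-walks-≤ p        (inj₁ _) zero = ≤-refl
  length-walks-≤ nothing  (inj₂ _) zero = ≤-refl
  length-walks-≤ (just _) (inj₂ _) zero = ≤-refl
  length-walks-≤ p (inj₁ v) (suc ℓ) = begin
    length (walks p (inj₁ v) (suc ℓ))                  ≤⟨ length-walks-suc-≤ p (inj₁ v) ℓ bound ⟩
    length (map inj₂ (incidentEdges v)) * #fromEdge ℓ  ≡⟨ cong (_* #fromEdge ℓ) (length-map inj₂ (incidentEdges v)) ⟩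
    deg G v * #fromEdge ℓ                              ≤⟨ *-monoˡ-≤ (#fromEdge ℓ) (<⇒≤ (deg<Δ v)) ⟩
    Δ * #fromEdge ℓ                                    ∎
    where
    open ≤-Reasoning
    bound : ∀ {z} → z ∈ successors p (inj₁ v) → #walks (just (inj₁ v)) z ℓ ≤ #fromEdge ℓ
    bound z∈ with ∈-map⁻ inj₂ z∈
    ... | _ , _ , refl = ≤-refl
  length-walks-≤ nothing (inj₂ e) (suc ℓ) =
    length-walks-suc-≤ nothing (inj₂ e) ℓ λ { (here refl) → ≤-refl ; (there (here refl)) → ≤-refl }
  length-walks-≤ (just (inj₁ u)) (inj₂ e) (suc ℓ) =
    ≤-trans (length-walks-suc-≤ (just (inj₁ u)) (inj₂ e) ℓ λ { (here refl) → ≤-refl }) (≤-reflexive (*-identityˡ _))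
  length-walks-≤ (just (inj₂ _)) (inj₂ e) (suc ℓ) = z≤n

  length-walks-suc-≤ p y ℓ bound = length-concatMap-≤ _ (successors p y) _ λ {z} z∈ →
    ≤-trans (≤-reflexive (length-map (z ∷_) (walks (just y) z ℓ))) (≤-trans (length-walks-≤ (just y) z ℓ) (bound z∈))

  #fromVertex-+-double : ∀ a d → #fromVertex (a + (d + d)) ≡ Δ ^ d * #fromVertex a
  #fromVertex-+-double a zero    = trans (cong #fromVertex (+-identityʳ a)) (sym (*-identityˡ _))
  #fromVertex-+-double a (suc d) = begin
    #fromVertex (a + (suc d + suc d))       ≡⟨ cong #fromVertex (shift a d) ⟩
    #fromVertex (suc (suc (a + (d + d))))   ≡⟨ two-steps (a + (d + d)) ⟩
    Δ * #fromVertex (a + (d + d))           ≡⟨ cong (Δ *_) (#fromVertex-+-double a d) ⟩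
    Δ * (Δ ^ d * #fromVertex a)             ≡⟨ *-assoc Δ _ _ ⟨
    Δ ^ suc d * #fromVertex a               ∎
    where
    open ≡-Reasoning
    shift : ∀ a d → a + (suc d + suc d) ≡ suc (suc (a + (d + d)))
    shift = solve-∀
    two-steps : ∀ ℓ → #fromVertex (suc (suc ℓ)) ≡ Δ * #fromVertex ℓ
    two-steps zero    = refl
    two-steps (suc ℓ) = refl

  #fromVertex-consecutive : ∀ l → #fromVertex l * #fromVertex (suc l) ≡ Δ ^ suc l
  #fromVertex-consecutive zero    = trans (+-identityʳ _) (trans (*-identityʳ Δ) (sym (*-identityʳ Δ)))
  #fromVertex-consecutive (suc l) = begin
    #fromVertex (suc l) * (Δ * #fromVertex l)   ≡⟨ rotate (#fromVertex (suc l)) Δ (#fromVertex l) ⟩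
    Δ * (#fromVertex l * #fromVertex (suc l))   ≡⟨ cong (Δ *_) (#fromVertex-consecutive l) ⟩
    Δ ^ suc (suc l)                             ∎
    where
    open ≡-Reasoning
    rotate : ∀ a b c → a * (b * c) ≡ b * (c * a)
    rotate = solve-∀

  walkFactor : Elt G → ℕ
  walkFactor (inj₁ _) = Δ
  walkFactor (inj₂ _) = 4

  #walks-pair : ∀ x l d → #walks nothing x l * #walks nothing x (suc l + (d + d)) ≤ walkFactor x * (Δ ^ l * Δ ^ d)
  #walks-pair (inj₁ _) l d = ≤-reflexive (begin
    #fromVertex l * #fromVertex (suc l + (d + d))   ≡⟨ cong (#fromVertex l *_) (#fromVertex-+-double (suc l) d) ⟩
    #fromVertex l * (Δ ^ d * #fromVertex (suc l))   ≡⟨ swap (#fromVertex l) (Δ ^ d) _ ⟩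
    Δ ^ d * (#fromVertex l * #fromVertex (suc l))   ≡⟨ cong (Δ ^ d *_) (#fromVertex-consecutive l) ⟩
    Δ ^ d * (Δ * Δ ^ l)                             ≡⟨ rotate (Δ ^ d) Δ (Δ ^ l) ⟩
    Δ * (Δ ^ l * Δ ^ d)                             ∎)
    where
    open ≡-Reasoning
    swap : ∀ a b c → a * (b * c) ≡ b * (a * c)
    swap = solve-∀
    rotate : ∀ a b c → a * (b * c) ≡ b * (c * a)
    rotate = solve-∀
  #walks-pair (inj₂ _) l d = begin
    #fromEdge₀ l * (2 * #fromVertex (l + (d + d)))   ≡⟨ cong (λ w → #fromEdge₀ l * (2 * w)) (#fromVertex-+-double l d) ⟩
    #fromEdge₀ l * (2 * (Δ ^ d * #fromVertex l))     ≡⟨ regroup (#fromEdge₀ l) (Δ ^ d) (#fromVertex l) ⟩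
    2 * Δ ^ d * (#fromEdge₀ l * #fromVertex l)       ≤⟨ *-monoʳ-≤ (2 * Δ ^ d) (edge-vertex l) ⟩
    2 * Δ ^ d * (2 * Δ ^ l)                          ≡⟨ collect (Δ ^ d) (Δ ^ l) ⟩
    4 * (Δ ^ l * Δ ^ d)                              ∎
    where
    open ≤-Reasoning
    edge-vertex : ∀ l → #fromEdge₀ l * #fromVertex l ≤ 2 * Δ ^ l
    edge-vertex zero    = s≤s z≤n
    edge-vertex (suc l) = ≤-reflexive (trans (*-assoc 2 (#fromVertex l) _) (cong (2 *_) (#fromVertex-consecutive l)))
    regroup : ∀ a b c → a * (2 * (b * c)) ≡ 2 * b * (a * c)
    regroup = solve-∀
    collect : ∀ a b → 2 * a * (2 * b) ≡ 4 * (b * a)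
    collect = solve-∀

-- Colorings

module Colorings (G : Graph) (L : Elt G → List ℕ) where

  open Walks G

  _[_↦_] : Coloring G → Elt G → Maybe ℕ → Coloring G
  (cv , ce) [ inj₁ v ↦ k ] = cv [ v ]≔ k , ce
  (cv , ce) [ inj₂ e ↦ k ] = cv , ce [ e ]≔ k

  col-↦-same : ∀ c y k → col G (c [ y ↦ k ]) y ≡ k
  col-↦-same (cv , ce) (inj₁ v) k = Vec.lookup∘update v cv k
  col-↦-same (cv , ce) (inj₂ e) k = Vec.lookup∘update e ce k

  col-↦-other : ∀ c y k {z} → z ≢ y → col G (c [ y ↦ k ]) z ≡ col G c z
  col-↦-other (cv , ce) (inj₁ v) k {inj₁ w} w≢v = Vec.lookup∘update′ (λ w≡v → w≢v (cong inj₁ w≡v)) cv k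
  col-↦-other (cv , ce) (inj₁ v) k {inj₂ f} _   = refl
  col-↦-other (cv , ce) (inj₂ e) k {inj₁ w} _   = refl
  col-↦-other (cv , ce) (inj₂ e) k {inj₂ f} f≢e = Vec.lookup∘update′ (λ f≡e → f≢e (cong inj₂ f≡e)) ce k

  Coloring-ext : ∀ c₁ c₂ → (∀ y → col G c₁ y ≡ col G c₂ y) → c₁ ≡ c₂
  Coloring-ext (cv , ce) (dv , de) c₁≗c₂ =
    cong₂ _,_ (Vec-ext cv dv (λ v → c₁≗c₂ (inj₁ v))) (Vec-ext ce de (λ e → c₁≗c₂ (inj₂ e)))

  _≟ᶜ_ : DecidableEquality (Coloring G)
  _≟ᶜ_ = Product.≡-dec (Vec.≡-dec (Maybe.≡-dec _≟_)) (Vec.≡-dec (Maybe.≡-dec _≟_))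

  _∈ᶜ?_ : (c : Coloring G) (cs : List (Coloring G)) → Dec (c ∈ cs)
  c ∈ᶜ? cs = DecMembership._∈?_ _≟ᶜ_ c cs

  erase : Coloring G → List (Elt G) → Coloring G
  erase c []      = c
  erase c (z ∷ Z) = erase c Z [ z ↦ nothing ]

  col-erase-∈ : ∀ c Z {y} → y ∈ Z → col G (erase c Z) y ≡ nothing
  col-erase-∈ c (z ∷ Z) (here refl) = col-↦-same (erase c Z) z nothing
  col-erase-∈ c (z ∷ Z) {y} (there y∈Z) with y ≟ᴱ z
  ... | yes refl = col-↦-same (erase c Z) z nothing
  ... | no  y≢z  = trans (col-↦-other (erase c Z) z nothing y≢z) (col-erase-∈ c Z y∈Z)

  col-erase-∉ : ∀ c Z {y} → y ∉ Z → col G (erase c Z) y ≡ col G c y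
  col-erase-∉ c []      _   = refl
  col-erase-∉ c (z ∷ Z) y∉ =
    trans (col-↦-other (erase c Z) z nothing (λ y≡z → y∉ (here y≡z))) (col-erase-∉ c Z (λ y∈Z → y∉ (there y∈Z)))

  IsColoring-erase : ∀ {S} Z {c} → IsColoring G L S c → IsColoring G L (Z ++ S) (erase c Z)
  IsColoring-erase {S} Z {c} (deleted , listed , thue) = deleted′ , listed′ , thue′
    where
    deleted′ : ∀ y → y ∈ Z ++ S → col G (erase c Z) y ≡ nothing
    deleted′ y y∈ with y ∈? Z | ∈-++⁻ Z y∈
    ... | yes y∈Z | _         = col-erase-∈ c Z y∈Z
    ... | no  y∉Z | inj₁ y∈Z  = ⊥-elim (y∉Z y∈Z)
    ... | no  y∉Z | inj₂ y∈S  = trans (col-erase-∉ c Z y∉Z) (deleted y y∈S)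
    listed′ : ∀ y → y ∉ Z ++ S → ∃ λ k → (col G (erase c Z) y ≡ just k) × (k ∈ L y)
    listed′ y y∉ = subst (λ k? → ∃ λ k → (k? ≡ just k) × (k ∈ L y))
                         (sym (col-erase-∉ c Z (λ y∈Z → y∉ (∈-++⁺ˡ y∈Z))))
                         (listed y (λ y∈S → y∉ (∈-++⁺ʳ Z y∈S)))
    thue′ : ∀ p → MixedPath G p → All (_∉ Z ++ S) p → NonRepetitive (map (col G (erase c Z)) p)
    thue′ p path avoids =
      subst NonRepetitive (sym (map-cong-local (All.map (λ y∉ → col-erase-∉ c Z (y∉ ∘ ∈-++⁺ˡ)) avoids)))
            (thue p path (All.map (λ y∉ → y∉ ∘ ∈-++⁺ʳ Z) avoids))

  options : Elt G → List (Maybe ℕ)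
  options y = nothing ∷ map just (L y)

  candidates : List (Coloring G)
  candidates = cartesianProduct (vectors (n G) (λ v → options (inj₁ v))) (vectors (m G) (λ e → options (inj₂ e)))

  IsColoring⇒∈candidates : ∀ S c → IsColoring G L S c → c ∈ candidates
  IsColoring⇒∈candidates S c@(cv , ce) (deleted , listed , _) =
    ∈-cartesianProduct⁺ (∈-vectors _ _ cv (λ v → col∈options (inj₁ v))) (∈-vectors _ _ ce (λ e → col∈options (inj₂ e)))
    where
    col∈options : ∀ y → col G c y ∈ options y
    col∈options y with y ∈? S
    ... | yes y∈S = here (deleted y y∈S)
    ... | no  y∉S with listed y y∉S
    ... | k , col≡k , k∈L = there (subst (_∈ map just (L y)) (sym col≡k) (∈-map⁺ just k∈L))

  ¬¬-enumeration-IsColoring : ∀ S → ¬ ¬ Σ (List (Coloring G)) (IsEnumeration (IsColoring G L S))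
  ¬¬-enumeration-IsColoring S = ¬¬-enumeration _≟ᶜ_ candidates (IsColoring⇒∈candidates S)

  Unique-elements : Unique elements
  Unique-elements = Unique.++⁺ (Unique.map⁺ Sum.inj₁-injective (Unique.allFin⁺ (n G)))
                               (Unique.map⁺ Sum.inj₂-injective (Unique.allFin⁺ (m G)))
                               λ (v∈ , e∈) → inj₁≢inj₂ (∈-map⁻ inj₁ v∈) (∈-map⁻ inj₂ e∈)
    where
    inj₁≢inj₂ : ∀ {y} → (∃ λ v → _ × y ≡ inj₁ v) → (∃ λ e → _ × y ≡ inj₂ e) → ⊥
    inj₁≢inj₂ (_ , _ , refl) (_ , _ , ())


  undeleted : List (Elt G) → List (Elt G)
  undeleted S = filter (λ y → ¬? (y ∈? S)) elements

  length-undeleted-< : ∀ {S S′ x} → S ⊆ S′ → x ∈ S′ → x ∉ S → length (undeleted S′) < length (undeleted S)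
  length-undeleted-< {S} {S′} {x} S⊆S′ x∈S′ x∉S = length-≤-⊆ {xs = x ∷ undeleted S′} unique subset
    where
    unique : Unique (x ∷ undeleted S′)
    unique = All.tabulate (λ y∈ x≡y → proj₂ (∈-filter⁻ (λ y → ¬? (y ∈? S′)) {xs = elements} y∈) (subst (_∈ S′) x≡y x∈S′))
           ∷ Unique.filter⁺ (λ y → ¬? (y ∈? S′)) Unique-elements
    subset : x ∷ undeleted S′ ⊆ undeleted S
    subset (here refl) = ∈-filter⁺ (λ y → ¬? (y ∈? S)) (∈-elements x) x∉S
    subset (there y∈)  = ∈-filter⁺ (λ y → ¬? (y ∈? S)) (∈-elements _)
                           (λ y∈S → proj₂ (∈-filter⁻ (λ y → ¬? (y ∈? S′)) {xs = elements} y∈) (S⊆S′ y∈S))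

  copy : List (Elt G × Elt G) → Coloring G → Coloring G
  copy []              r = r
  copy ((y , y′) ∷ ps) r = copy ps r [ y ↦ col G r y′ ]

  col-copy-∉ : ∀ ps r {y} → y ∉ map proj₁ ps → col G (copy ps r) y ≡ col G r y
  col-copy-∉ []              r _  = refl
  col-copy-∉ ((z , z′) ∷ ps) r y∉ =
    trans (col-↦-other (copy ps r) z _ (λ y≡z → y∉ (here y≡z))) (col-copy-∉ ps r (λ y∈ → y∉ (there y∈)))

  col-copy-∈ : ∀ ps r {y y′} → Unique (map proj₁ ps) → (y , y′) ∈ ps → col G (copy ps r) y ≡ col G r y′
  col-copy-∈ ((z , z′) ∷ ps) r _       (here refl) = col-↦-same (copy ps r) z _
  col-copy-∈ ((z , z′) ∷ ps) r (p ∷ u) (there y∈)  =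
    trans (col-↦-other (copy ps r) z _ (λ y≡z → All.lookup p (∈-map⁺ proj₁ y∈) (sym y≡z))) (col-copy-∈ ps r u y∈)

  copy-zip-square : ∀ e r F F′ → Unique (F ++ F′) → length F ≡ length F′ → map (col G e) F ≡ map (col G e) F′ →
                    (∀ {y} → y ∉ F → col G r y ≡ col G e y) → copy (zip F F′) r ≡ e
  copy-zip-square e r F F′ unique len square agree = Coloring-ext _ e pointwise
    where
    proj₁-zip : map proj₁ (zip F F′) ≡ F
    proj₁-zip = map-proj₁-zip F F′ len
    pointwise : ∀ y → col G (copy (zip F F′) r) y ≡ col G e y
    pointwise y with y ∈? F
    ... | yes y∈F = let y′ , yy′∈ = ∈-zip⁺ˡ F F′ len y∈F in begin
      col G (copy (zip F F′) r) y  ≡⟨ col-copy-∈ (zip F F′) r (subst Unique (sym proj₁-zip) (Unique-++⁻ˡ F unique)) yy′∈ ⟩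
      col G r y′                   ≡⟨ agree (λ y′∈F → Unique-++-disjoint F unique y′∈F (∈-zip⁻ʳ F F′ yy′∈)) ⟩
      col G e y′                   ≡⟨ map-≡-zip (col G e) F F′ square yy′∈ ⟨
      col G e y                    ∎
      where open ≡-Reasoning
    ... | no y∉F = trans (col-copy-∉ (zip F F′) r (subst (y ∉_) (sym proj₁-zip) y∉F)) (agree y∉F)

-- Counting extensions

HasSquare : {A : Set} → List A → Set
HasSquare {A} xs = Σ (List A) λ as → Σ (List A) λ ys → Σ (List A) λ bs → (ys ≢ []) × (xs ≡ as ++ (ys ++ ys) ++ bs)

module Extension (G : Graph) (Δ : ℕ) (deg<Δ : ∀ v → deg G v < Δ) (L : Elt G → List ℕ)
                 (L-unique : ∀ y → Unique (L y)) where

  open Walks G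
  open WalkCount G Δ deg<Δ
  open Colorings G L

  numK denK : Bool → ℕ
  numK true  = 162
  numK false = 42
  denK true  = 100
  denK false = 10

  denK-numK : ∀ t → denK t * denK (not t) + 5804 ≡ numK t * numK (not t)
  denK-numK true  = refl
  denK-numK false = refl

  numK-product-nonZero : ∀ t → NonZero (numK t * numK (not t))
  numK-product-nonZero true  = _
  numK-product-nonZero false = _

  -- √(K₂ t / K₁ t) = 6804 (a + c) / (5804 a), for a = numK t and c = denK t, is the bound of
  -- Σ<-alternating on the series summing over walks whose first element has type t.
  K₁ K₂ : Bool → ℕ
  K₁ t = 5804 * numK t * (5804 * numK t)
  K₂ t = numK t * numK (not t) * (numK t + denK t) * (numK t * numK (not t) * (numK t + denK t))

  -- α y = αnum y / αden y is the factor the paper proves: 1.62Δ for vertices, 4.2Δ for edges.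
  αnum αden : Elt G → ℕ
  αnum y = numK (isVertex y) * Δ
  αden y = denK (isVertex y)

  Claim : List (Elt G) → Elt G → Set
  Claim S x = ∀ a b → HasSize (IsColoring G L S) a → HasSize (IsColoring G L (x ∷ S)) b → αnum x * b ≤ αden x * a

  product-αnum-take : ∀ b w d → Alternating b w → d ≤ length w →
                      product (map αnum (take d w)) ≡ Δ ^ d * alternating (numK b) (numK (not b)) d
  product-αnum-take b w       zero    _            _         = refl
  product-αnum-take b (z ∷ w) (suc d) (refl , alt) (s≤s d≤w) = begin
    numK b * Δ * product (map αnum (take d w))                     ≡⟨ cong (numK b * Δ *_) (product-αnum-take (not b) w d alt d≤w) ⟩
    numK b * Δ * (Δ ^ d * alternating (numK (not b)) (numK (not (not b))) d)
      ≡⟨ cong (λ b′ → numK b * Δ * (Δ ^ d * alternating (numK (not b)) (numK b′) d)) (not-involutive b) ⟩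
    numK b * Δ * (Δ ^ d * alternating (numK (not b)) (numK b) d)   ≡⟨ regroup (numK b) Δ (Δ ^ d) _ ⟩
    Δ * Δ ^ d * (numK b * alternating (numK (not b)) (numK b) d)   ∎
    where
    open ≡-Reasoning
    regroup : ∀ k D P a → k * D * (P * a) ≡ D * P * (k * a)
    regroup = solve-∀

  product-αden-take : ∀ b w d → Alternating b w → d ≤ length w →
                      product (map αden (take d w)) ≡ alternating (denK b) (denK (not b)) d
  product-αden-take b w       zero    _            _         = refl
  product-αden-take b (z ∷ w) (suc d) (refl , alt) (s≤s d≤w) =
    cong (denK b *_) (trans (product-αden-take (not b) w d alt d≤w)
                            (cong (λ b′ → alternating (denK (not b)) (denK b′) d) (not-involutive b)))

  module _ (S : List (Elt G)) (x : Elt G) (x∉S : x ∉ S) where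

    module Iterated (ih : ∀ S′ → x ∷ S ⊆ S′ → ∀ y → y ∉ S′ → Claim S′ y)
                    {b} (size-xS : HasSize (IsColoring G L (x ∷ S)) b) where

      -- Deleting the elements of H one at a time, each deletion divides the count by at least α.
      iterated-claim : ∀ H → Unique H → All (_∉ x ∷ S) H → ∀ c → HasSize (IsColoring G L (H ++ x ∷ S)) c →
                       product (map αnum H) * c ≤ product (map αden H) * b
      iterated-claim []      _         _              c size-c = *-monoʳ-≤ 1 (HasSize-mono size-c size-xS (λ _ col → col))
      iterated-claim (h ∷ H) (h∉H ∷ u) (h∉xS ∷ H∉xS) c size-c =
        decidable-stable (_ ≤? _) (¬¬-enumeration-IsColoring (H ++ x ∷ S) >>= λ (_ , enum′) →
                                     pure (through-H (IsEnumeration⇒HasSize enum′)))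
        where
        open ≤-Reasoning
        h∉HxS : h ∉ H ++ x ∷ S
        h∉HxS h∈ with ∈-++⁻ H h∈
        ... | inj₁ h∈H  = All.lookup h∉H h∈H refl
        ... | inj₂ h∈xS = h∉xS h∈xS
        swap : ∀ a p c → a * p * c ≡ p * (a * c)
        swap = solve-∀
        swap′ : ∀ p a c → p * (a * c) ≡ a * (p * c)
        swap′ = solve-∀
        through-H : ∀ {c′} → HasSize (IsColoring G L (H ++ x ∷ S)) c′ →
                    αnum h * product (map αnum H) * c ≤ αden h * product (map αden H) * b
        through-H {c′} size-c′ = begin
          αnum h * product (map αnum H) * c     ≡⟨ swap (αnum h) _ c ⟩
          product (map αnum H) * (αnum h * c)   ≤⟨ *-monoʳ-≤ (product (map αnum H)) (ih _ (∈-++⁺ʳ H) h h∉HxS c′ c size-c′ size-c) ⟩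
          product (map αnum H) * (αden h * c′)  ≡⟨ swap′ (product (map αnum H)) (αden h) c′ ⟩
          αden h * (product (map αnum H) * c′)  ≤⟨ *-monoʳ-≤ (αden h) (iterated-claim H u H∉xS c′ size-c′) ⟩
          αden h * (product (map αden H) * b)   ≡⟨ *-assoc (αden h) _ b ⟨
          αden h * product (map αden H) * b     ∎

    nbrIsVertex : Bool
    nbrIsVertex = not (isVertex x)

    K₁ₓ K₂ₓ : ℕ
    K₁ₓ = K₁ nbrIsVertex
    K₂ₓ = K₂ nbrIsVertex

    extend : Coloring G → ℕ → Coloring G
    extend c κ = c [ x ↦ just κ ]

    record CentredSquare (e : Coloring G) : Set where
      field
        A B    : List (Elt G)
        zs     : List (Maybe ℕ)
        path   : MixedPath G (reverse A ++ x ∷ B)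
        avoids : All (_∉ S) (reverse A ++ x ∷ B)
        square : map (col G e) (reverse A ++ x ∷ B) ≡ zs ++ zs
        x-in-first-half : length A < length zs

    mkCentredSquare : ∀ {e} A B zs {q} → q ≡ reverse A ++ x ∷ B → MixedPath G q → All (_∉ S) q →
                    map (col G e) q ≡ zs ++ zs → length A < length zs → CentredSquare e
    mkCentredSquare A B zs refl path avoids square lt = record
      { A = A ; B = B ; zs = zs ; path = path ; avoids = avoids ; square = square ; x-in-first-half = lt }

    -- A square of extend c κ must pass through x, since c itself has none; reversing the
    -- path if necessary puts x into the first half.
    square⇒CentredSquare : ∀ {c κ} → IsColoring G L (x ∷ S) c → ∀ p → MixedPath G p → All (_∉ S) p →
                     HasSquare (map (col G (extend c κ)) p) → CentredSquare (extend c κ)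
    square⇒CentredSquare {c} {κ} (_ , _ , c-thue) p (linked , unique) avoids (as , ys , bs , ys≢[] , colours)
      with map-≡-++ (col G (extend c κ)) p as ((ys ++ ys) ++ bs) colours
    ... | P₁ , P′ , refl , _ , colours′ with map-≡-++ (col G (extend c κ)) P′ (ys ++ ys) bs colours′
    ... | Q , P₂ , refl , Q-square , _ = through (x ∈? Q)
      where
      e = extend c κ
      Q-path : MixedPath G Q
      Q-path = Linked-++⁻ˡ Q (Linked-++⁻ʳ P₁ linked) , Unique-++⁻ˡ Q (Unique-++⁻ʳ P₁ unique)
      Q-avoids : All (_∉ S) Q
      Q-avoids = All.++⁻ˡ Q (All.++⁻ʳ P₁ avoids)
      through : Dec (x ∈ Q) → CentredSquare e
      through (no x∉Q) = ⊥-elim (c-thue Q Q-path Q-avoids-xS ([] , ys , [] , ys≢[] , c-square))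
        where
        Q-avoids-xS : All (_∉ x ∷ S) Q
        Q-avoids-xS = All.tabulate λ y∈Q → λ { (here refl) → x∉Q y∈Q ; (there y∈S) → All.lookup Q-avoids y∈Q y∈S }
        c-square : map (col G c) Q ≡ [] ++ (ys ++ ys) ++ []
        c-square = begin
          map (col G c) Q   ≡⟨ map-cong-local (All.tabulate λ y∈Q → col-↦-other c x _ (λ y≡x → x∉Q (subst (_∈ Q) y≡x y∈Q))) ⟨
          map (col G e) Q   ≡⟨ Q-square ⟩
          ys ++ ys          ≡⟨ ++-identityʳ (ys ++ ys) ⟨
          (ys ++ ys) ++ []  ∎
          where open ≡-Reasoning
      through (yes x∈Q) with ∈-∃++ x∈Q
      ... | U , V , refl with length U <? length ys
      ... | yes U<ys = mkCentredSquare (reverse U) V ys (cong (_++ x ∷ V) (sym (reverse-involutive U)))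
                         Q-path Q-avoids Q-square (subst (_< length ys) (sym (length-reverse U)) U<ys)
      ... | no  U≮ys = mkCentredSquare V (reverse U) (reverse ys) reverse-Q (MixedPath-reverse Q-path)
                         (All.anti-mono Any.reverse⁻ Q-avoids) reverse-square (subst (length V <_) (sym (length-reverse ys)) V<ys)
        where
        reverse-Q : reverse (U ++ x ∷ V) ≡ reverse V ++ x ∷ reverse U
        reverse-Q = trans (reverse-++ U (x ∷ V))
                          (trans (cong (_++ reverse U) (unfold-reverse x V)) (++-assoc (reverse V) (x ∷ []) (reverse U)))
        reverse-square : map (col G e) (reverse (U ++ x ∷ V)) ≡ reverse ys ++ reverse ys
        reverse-square = trans (reverse-map (col G e) (U ++ x ∷ V)) (trans (cong reverse Q-square) (reverse-++ ys ys))
        V<ys : length V < length ys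
        V<ys = +-cancelˡ-≤ (length ys) _ _ (begin
          length ys + suc (length V)  ≤⟨ +-monoˡ-≤ (suc (length V)) (≮⇒≥ U≮ys) ⟩
          length U + suc (length V)   ≡⟨ length-++ U ⟨
          length (U ++ x ∷ V)         ≡⟨ length-map (col G e) (U ++ x ∷ V) ⟨
          length (map (col G e) (U ++ x ∷ V)) ≡⟨ cong length Q-square ⟩
          length (ys ++ ys)           ≡⟨ length-++ ys ⟩
          length ys + length ys       ∎)
          where open ≤-Reasoning

    extensions : List (Coloring G) → List (Coloring G)
    extensions cs = map (λ cκ → extend (proj₁ cκ) (proj₂ cκ)) (cartesianProduct cs (L x))

    length-extensions : ∀ cs → length (extensions cs) ≡ length cs * length (L x)
    length-extensions cs = trans (length-map _ (cartesianProduct cs (L x))) (length-cartesianProduct cs (L x))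

    Unique-extensions : ∀ {cs} → Unique cs → (∀ {c} → c ∈ cs → col G c x ≡ nothing) → Unique (extensions cs)
    Unique-extensions {cs} unique x-free =
      Unique-map⁺-∈ _ extend-injective (Unique.cartesianProduct⁺ unique (L-unique x))
      where
      extend-injective : ∀ {p q} → p ∈ cartesianProduct cs (L x) → q ∈ cartesianProduct cs (L x) →
                         extend (proj₁ p) (proj₂ p) ≡ extend (proj₁ q) (proj₂ q) → p ≡ q
      extend-injective {c₁ , κ₁} {c₂ , κ₂} p∈ q∈ same = cong₂ _,_ (Coloring-ext c₁ c₂ agree) κ₁≡κ₂
        where
        κ₁≡κ₂ : κ₁ ≡ κ₂
        κ₁≡κ₂ = Maybe.just-injective
                  (trans (sym (col-↦-same c₁ x _)) (trans (cong (λ c → col G c x) same) (col-↦-same c₂ x _)))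
        agree : ∀ y → col G c₁ y ≡ col G c₂ y
        agree y with y ≟ᴱ x
        ... | yes refl = trans (x-free (proj₁ (∈-cartesianProduct⁻ cs (L x) p∈)))
                               (sym (x-free (proj₁ (∈-cartesianProduct⁻ cs (L x) q∈))))
        ... | no  y≢x  = trans (sym (col-↦-other c₁ x _ y≢x)) (trans (cong (λ c → col G c y) same) (col-↦-other c₂ x _ y≢x))

    -- Squares have l, d < length elements; doubling gives the even range Σ<²-alternating sums over.
    M : ℕ
    M = length elements + length elements

    walkPairs : ℕ → ℕ → List (List (Elt G) × List (Elt G))
    walkPairs l d = cartesianProduct (walks nothing x l) (walks nothing x (suc l + (d + d)))

    firstHalf firstHalf⁻ : ℕ → List (Elt G) → List (Elt G) → List (Elt G)
    firstHalf  d A B = reverse A ++ x ∷ take d B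
    firstHalf⁻ d A B = reverse A ++ take d B

    deletedSet : ℕ → List (Elt G) → List (Elt G) → List (Elt G)
    deletedSet d A B = firstHalf⁻ d A B ++ x ∷ S

    deletedSets : List (List (Elt G))
    deletedSets = concat< M λ l → concat< M λ d → map (λ AB → deletedSet d (proj₁ AB) (proj₂ AB)) (walkPairs l d)

    restore : ℕ → List (Elt G) → List (Elt G) → Coloring G → Coloring G
    restore d A B = copy (zip (firstHalf d A B) (drop d B))

    path-halves : ∀ d A B → reverse A ++ x ∷ B ≡ firstHalf d A B ++ drop d B
    path-halves d A B = begin
      reverse A ++ x ∷ B                          ≡⟨ cong (λ B′ → reverse A ++ x ∷ B′) (take++drop≡id d B) ⟨
      reverse A ++ x ∷ (take d B ++ drop d B)     ≡⟨ ++-assoc (reverse A) (x ∷ take d B) (drop d B) ⟨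
      firstHalf d A B ++ drop d B                 ∎
      where open ≡-Reasoning

    module Geometry {e} (sq : CentredSquare e) where

      open CentredSquare sq

      l k d : ℕ
      l = length A
      k = length zs
      d = k ∸ suc l

      1+l+d≡k : suc l + d ≡ k
      1+l+d≡k = m+[n∸m]≡n x-in-first-half

      length-path : length (reverse A ++ x ∷ B) ≡ k + k
      length-path = begin
        length (reverse A ++ x ∷ B)              ≡⟨ length-map (col G e) (reverse A ++ x ∷ B) ⟨
        length (map (col G e) (reverse A ++ x ∷ B)) ≡⟨ cong length square ⟩
        length (zs ++ zs)                        ≡⟨ length-++ zs ⟩
        k + k                                    ∎
        where open ≡-Reasoning

      length-B : length B ≡ suc l + (d + d)
      length-B = suc-injective (+-cancelˡ-≡ l _ _ (begin
        l + suc (length B)                  ≡⟨ cong (_+ suc (length B)) (length-reverse A) ⟨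
        length (reverse A) + suc (length B) ≡⟨ length-++ (reverse A) ⟨
        length (reverse A ++ x ∷ B)         ≡⟨ length-path ⟩
        k + k                               ≡⟨ cong₂ _+_ 1+l+d≡k 1+l+d≡k ⟨
        suc l + d + (suc l + d)             ≡⟨ regroup l d ⟩
        l + suc (suc l + (d + d))           ∎))
        where
        open ≡-Reasoning
        regroup : ∀ l d → suc l + d + (suc l + d) ≡ l + suc (suc l + (d + d))
        regroup = solve-∀

      k≤elements : k ≤ length elements
      k≤elements = ≤-trans (m≤m+n k k) (subst (_≤ length elements) length-path
                                          (length-≤-⊆ (proj₂ path) (λ {y} _ → ∈-elements y)))

      l<M : l < M
      l<M = ≤-trans x-in-first-half (≤-trans k≤elements (m≤m+n _ _))

      d<M : d < M
      d<M = ≤-trans (≤-trans (s≤s (m≤n+m d l)) (≤-reflexive 1+l+d≡k)) (≤-trans k≤elements (m≤m+n _ _))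

      A∈walks : A ∈ walks nothing x l
      A∈walks = ∈-walks nothing x A tt
                  (subst (Linked (Inc G)) x∷A (Linked-reverse⁺ Inc-sym _ (Linked-++⁻ˡ (reverse A ∷ʳ x) linked′)))
                  (subst Unique x∷A (Unique-reverse⁺ _ (Unique-++⁻ˡ (reverse A ∷ʳ x) unique′)))
        where
        reassociate : reverse A ++ x ∷ B ≡ (reverse A ∷ʳ x) ++ B
        reassociate = sym (++-assoc (reverse A) (x ∷ []) B)
        linked′ = subst (Linked (Inc G)) reassociate (proj₁ path)
        unique′ = subst Unique reassociate (proj₂ path)
        x∷A : reverse (reverse A ∷ʳ x) ≡ x ∷ A
        x∷A = trans (reverse-++ (reverse A) (x ∷ [])) (cong (x ∷_) (reverse-involutive A))

      B∈walks : B ∈ walks nothing x (suc l + (d + d))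
      B∈walks = subst (λ n → B ∈ walks nothing x n) length-B
                  (∈-walks nothing x B tt (Linked-++⁻ʳ (reverse A) (proj₁ path)) (Unique-++⁻ʳ (reverse A) (proj₂ path)))

      length-firstHalf : length (firstHalf d A B) ≡ k
      length-firstHalf = begin
        length (reverse A ++ x ∷ take d B)        ≡⟨ length-++ (reverse A) ⟩
        length (reverse A) + suc (length (take d B))
                                                  ≡⟨ cong₂ (λ a m → a + suc m) (length-reverse A) (trans (length-take d B) (m≤n⇒m⊓n≡m d≤B)) ⟩
        l + suc d                                 ≡⟨ +-suc l d ⟩
        suc l + d                                 ≡⟨ 1+l+d≡k ⟩
        k                                         ∎
        where
        open ≡-Reasoning
        d≤B : d ≤ length B
        d≤B = subst (d ≤_) (sym length-B) (≤-trans (m≤m+n d d) (m≤n+m (d + d) (suc l)))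

      length-secondHalf : length (drop d B) ≡ k
      length-secondHalf = trans (length-drop d B) (trans (cong (_∸ d) length-B) (trans (drop-d l d) 1+l+d≡k))
        where
        drop-d : ∀ l d → suc l + (d + d) ∸ d ≡ suc l + d
        drop-d l d = trans (cong (_∸ d) (sym (+-assoc (suc l) d d))) (m+n∸n≡m (suc l + d) d)

      halves-agree : map (col G e) (firstHalf d A B) ≡ map (col G e) (drop d B)
      halves-agree = trans (proj₁ halves) (sym (proj₂ halves))
        where
        halves = ++-injective (map (col G e) (firstHalf d A B)) zs
                   (trans (length-map (col G e) (firstHalf d A B)) length-firstHalf)
                   (trans (sym (map-++ (col G e) (firstHalf d A B) (drop d B)))
                          (trans (cong (map (col G e)) (sym (path-halves d A B))) square))

    Admissible : List (Elt G) → List (Elt G) → Set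
    Admissible A B = Unique (reverse A ++ x ∷ B) × All (_∉ S) (reverse A ++ x ∷ B)

    admissible? : ∀ A B → Dec (Admissible A B)
    admissible? A B = unique? _ ×-dec All.all? (λ y → ¬? (y ∈? S)) _
      where open import Data.List.Relation.Unary.Unique.DecPropositional _≟ᴱ_ using (unique?)

    firstHalf⁻⊆firstHalf : ∀ d A B → firstHalf⁻ d A B ⊆ firstHalf d A B
    firstHalf⁻⊆firstHalf d A B y∈ with ∈-++⁻ (reverse A) y∈
    ... | inj₁ y∈A = ∈-++⁺ˡ y∈A
    ... | inj₂ y∈B = ∈-++⁺ʳ (reverse A) (there y∈B)

    firstHalf⁻-admissible : ∀ d A B → Admissible A B → Unique (firstHalf⁻ d A B) × All (_∉ x ∷ S) (firstHalf⁻ d A B)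
    firstHalf⁻-admissible d A B (unique , avoids) = Unique-++-∷⁻ (reverse A) first-unique , All.tabulate avoids-xS
      where
      first-unique : Unique (firstHalf d A B)
      first-unique = Unique-++⁻ˡ (firstHalf d A B) (subst Unique (path-halves d A B) unique)
      avoids-xS : ∀ {y} → y ∈ firstHalf⁻ d A B → y ∉ x ∷ S
      avoids-xS y∈ (here refl) = Unique-++-∷⇒∉ (reverse A) first-unique y∈
      avoids-xS y∈ (there y∈S) =
        All.lookup avoids (subst (_ ∈_) (sym (path-halves d A B)) (∈-++⁺ˡ (firstHalf⁻⊆firstHalf d A B y∈))) y∈S

    module Restorations (enum : List (Elt G) → List (Coloring G)) where

      block : ℕ → List (Elt G) × List (Elt G) → List (Coloring G)
      block d (A , B) with admissible? A B
      ... | yes _ = map (restore d A B) (enum (deletedSet d A B))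
      ... | no  _ = []

      restorations : ℕ → ℕ → List (Coloring G)
      restorations l d = concatMap (block d) (walkPairs l d)

      restored : List (Coloring G)
      restored = concat< M λ l → concat< M (restorations l)

      -- Every extension with a centred square is restored from its restriction off the first half.
      CentredSquare⇒∈restored : (∀ {T} → T ∈ deletedSets → IsEnumeration (IsColoring G L T) (enum T)) →
                          ∀ {c κ} → IsColoring G L (x ∷ S) c → CentredSquare (extend c κ) → extend c κ ∈ restored
      CentredSquare⇒∈restored enum-spec {c} {κ} c-colors sq =
        ∈-concat< M _ l<M (∈-concat< M _ d<M (∈-concatMap⁺ (block d) (lose (∈-cartesianProduct⁺ A∈walks B∈walks) e∈block)))
        where
        open CentredSquare sq
        open Geometry sq
        e = extend c κ
        F = firstHalf d A B
        H = firstHalf⁻ d A B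
        r = erase c H
        r∈enum : r ∈ enum (deletedSet d A B)
        r∈enum = Equivalence.to (proj₂ (enum-spec T∈) r) (IsColoring-erase H c-colors)
          where
          T∈ : deletedSet d A B ∈ deletedSets
          T∈ = ∈-concat< M _ l<M (∈-concat< M _ d<M (∈-map⁺ _ (∈-cartesianProduct⁺ A∈walks B∈walks)))
        x∈F : x ∈ F
        x∈F = ∈-++⁺ʳ (reverse A) (here refl)
        agree : ∀ {y} → y ∉ F → col G r y ≡ col G e y
        agree {y} y∉F = trans (col-erase-∉ c H (λ y∈H → y∉F (firstHalf⁻⊆firstHalf d A B y∈H)))
                              (sym (col-↦-other c x _ (λ y≡x → y∉F (subst (_∈ F) (sym y≡x) x∈F))))
        restore≡e : restore d A B r ≡ e
        restore≡e = copy-zip-square e r F (drop d B) (subst Unique (path-halves d A B) (proj₂ path))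
                     (trans length-firstHalf (sym length-secondHalf)) halves-agree agree
        e∈block : e ∈ block d (A , B)
        e∈block with admissible? A B
        ... | yes _           = subst (_∈ _) restore≡e (∈-map⁺ (restore d A B) r∈enum)
        ... | no  ¬admissible = ⊥-elim (¬admissible (proj₂ path , avoids))

      extension-restored-or-colors : (∀ {T} → T ∈ deletedSets → IsEnumeration (IsColoring G L T) (enum T)) →
                                 ∀ {c κ} → IsColoring G L (x ∷ S) c → κ ∈ L x →
                                 extend c κ ∈ restored ⊎ IsColoring G L S (extend c κ)
      extension-restored-or-colors enum-spec {c} {κ} c-colors@(deleted , listed , _) κ∈L with extend c κ ∈ᶜ? restored
      ... | yes e∈restored = inj₁ e∈restored
      ... | no  e∉restored = inj₂ (deleted′ , listed′ , λ p path avoids square →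
                              e∉restored (CentredSquare⇒∈restored enum-spec c-colors (square⇒CentredSquare c-colors p path avoids square)))
        where
        deleted′ : ∀ y → y ∈ S → col G (extend c κ) y ≡ nothing
        deleted′ y y∈S = trans (col-↦-other c x _ (λ y≡x → x∉S (subst (_∈ S) y≡x y∈S))) (deleted y (there y∈S))
        listed′ : ∀ y → y ∉ S → ∃ λ k → (col G (extend c κ) y ≡ just k) × (k ∈ L y)
        listed′ y y∉S with y ≟ᴱ x
        ... | yes refl = κ , col-↦-same c x _ , κ∈L
        ... | no  y≢x  = subst (λ k? → ∃ λ k → (k? ≡ just k) × (k ∈ L y)) (sym (col-↦-other c x _ y≢x))
                               (listed y λ { (here y≡x) → y≢x y≡x ; (there y∈S) → y∉S y∈S })

      module Count (enum-spec : ∀ {T} → T ∈ deletedSets → IsEnumeration (IsColoring G L T) (enum T))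
                   (ih : ∀ S′ → x ∷ S ⊆ S′ → ∀ y → y ∉ S′ → Claim S′ y)
                   {b} (size-xS : HasSize (IsColoring G L (x ∷ S)) b) ⦃ _ : NonZero Δ ⦄ where

        open Iterated ih size-xS

        altNum altDen : ℕ → ℕ
        altNum = alternating (numK nbrIsVertex) (numK (not nbrIsVertex))
        altDen = alternating (denK nbrIsVertex) (denK (not nbrIsVertex))

        product-firstHalf⁻ : ∀ (f : Elt G → ℕ) (P : Bool → ℕ → ℕ) →
                             (∀ u w j → Alternating u w → j ≤ length w → product (map f (take j w)) ≡ P u j) →
                             ∀ {l d A B} → (A , B) ∈ walkPairs l d →
                             product (map f (firstHalf⁻ d A B)) ≡ P nbrIsVertex l * P nbrIsVertex d
        product-firstHalf⁻ f P product-take {l} {d} {A} {B} AB∈ = begin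
          product (map f (reverse A ++ take d B))                      ≡⟨ cong product (map-++ f (reverse A) (take d B)) ⟩
          product (map f (reverse A) ++ map f (take d B))              ≡⟨ product-++ (map f (reverse A)) _ ⟩
          product (map f (reverse A)) * product (map f (take d B))     ≡⟨ cong (_* _) (product-map-reverse f A) ⟩
          product (map f A) * product (map f (take d B))
            ≡⟨ cong (λ A′ → product (map f A′) * _) (take-all l A (≤-reflexive l≡A)) ⟨
          product (map f (take l A)) * product (map f (take d B))
            ≡⟨ cong₂ _*_ (product-take nbrIsVertex A l (walks-alternate {nothing} {x} {l} A∈) (≤-reflexive (sym l≡A)))
                         (product-take nbrIsVertex B d (walks-alternate {nothing} {x} {suc l + (d + d)} B∈) d≤B) ⟩
          P nbrIsVertex l * P nbrIsVertex d                            ∎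
          where
          open ≡-Reasoning
          A∈ = proj₁ (∈-cartesianProduct⁻ (walks nothing x l) _ AB∈)
          B∈ = proj₂ (∈-cartesianProduct⁻ (walks nothing x l) _ AB∈)
          l≡A : length A ≡ l
          l≡A = length-walks {nothing} {x} {l} A∈
          d≤B : d ≤ length B
          d≤B = subst (d ≤_) (sym (length-walks {nothing} {x} {suc l + (d + d)} B∈)) (≤-trans (m≤m+n d d) (m≤n+m (d + d) (suc l)))

        block-bound : ∀ {l d A B} → l < M → d < M → (A , B) ∈ walkPairs l d →
                      length (block d (A , B)) * (Δ ^ l * altNum l * (Δ ^ d * altNum d)) ≤ altDen l * altDen d * b
        block-bound {l} {d} {A} {B} l<M d<M AB∈ with admissible? A B
        ... | no  _          = z≤n
        ... | yes admissible = begin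
          length (map (restore d A B) (enum T)) * (Δ ^ l * altNum l * (Δ ^ d * altNum d))
                                                               ≡⟨ cong₂ _*_ (length-map _ (enum T)) (sym numerators) ⟩
          length (enum T) * product (map αnum H)               ≡⟨ *-comm (length (enum T)) _ ⟩
          product (map αnum H) * length (enum T)               ≤⟨ iterated-claim H H-unique H-avoids _ (IsEnumeration⇒HasSize enum-T) ⟩
          product (map αden H) * b                             ≡⟨ cong (_* b) denominators ⟩
          altDen l * altDen d * b                              ∎
          where
          open ≤-Reasoning
          T = deletedSet d A B
          H = firstHalf⁻ d A B
          enum-T = enum-spec (∈-concat< M _ l<M (∈-concat< M _ d<M (∈-map⁺ _ AB∈)))
          H-unique = proj₁ (firstHalf⁻-admissible d A B admissible)
          H-avoids = proj₂ (firstHalf⁻-admissible d A B admissible)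
          numerators : product (map αnum H) ≡ Δ ^ l * altNum l * (Δ ^ d * altNum d)
          numerators = product-firstHalf⁻ αnum (λ u j → Δ ^ j * alternating (numK u) (numK (not u)) j) product-αnum-take {l} {d} AB∈
          denominators : product (map αden H) ≡ altDen l * altDen d
          denominators = product-firstHalf⁻ αden (λ u → alternating (denK u) (denK (not u))) product-αden-take {l} {d} AB∈

        restorations-bound : ∀ l d → l < M → d < M →
                             length (restorations l d) * altNum l * altNum d ≤ walkFactor x * b * altDen l * altDen d
        restorations-bound l d l<M d<M =
          *-cancelˡ-≤ (Δ ^ l * Δ ^ d) ⦃ m*n≢0 (Δ ^ l) (Δ ^ d) ⦃ m^n≢0 Δ l ⦄ ⦃ m^n≢0 Δ d ⦄ ⦄ (begin
          Δ ^ l * Δ ^ d * (X * altNum l * altNum d)             ≡⟨ regroup (Δ ^ l) (Δ ^ d) X (altNum l) (altNum d) ⟩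
          X * (Δ ^ l * altNum l * (Δ ^ d * altNum d))           ≤⟨ length-concatMap-*-≤ (block d) (walkPairs l d) _ _ (block-bound l<M d<M) ⟩
          length (walkPairs l d) * (altDen l * altDen d * b)    ≤⟨ *-monoˡ-≤ _ #walkPairs ⟩
          walkFactor x * (Δ ^ l * Δ ^ d) * (altDen l * altDen d * b)
                                                                ≡⟨ regroup′ (walkFactor x) (Δ ^ l * Δ ^ d) (altDen l) (altDen d) b ⟩
          Δ ^ l * Δ ^ d * (walkFactor x * b * altDen l * altDen d) ∎)
          where
          open ≤-Reasoning
          X = length (restorations l d)
          #walkPairs : length (walkPairs l d) ≤ walkFactor x * (Δ ^ l * Δ ^ d)
          #walkPairs = ≤-trans (≤-reflexive (length-cartesianProduct (walks nothing x l) _))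
                               (≤-trans (*-mono-≤ (length-walks-≤ nothing x l) (length-walks-≤ nothing x (suc l + (d + d))))
                                        (#walks-pair x l d))
          regroup : ∀ P Q X a b → P * Q * (X * a * b) ≡ X * (P * a * (Q * b))
          regroup = solve-∀
          regroup′ : ∀ w PQ u v b → w * PQ * (u * v * b) ≡ PQ * (w * b * u * v)
          regroup′ = solve-∀

        length-restored : K₁ₓ * length restored ≤ K₂ₓ * (walkFactor x * b)
        length-restored = subst (λ w → K₁ₓ * w ≤ K₂ₓ * (walkFactor x * b)) (sym length-restored≡)
          (Σ<²-alternating {numK nbrIsVertex} {numK (not nbrIsVertex)} {denK nbrIsVertex} {denK (not nbrIsVertex)} {5804}
                           ⦃ numK-product-nonZero nbrIsVertex ⦄ (denK-numK nbrIsVertex) (length elements) _ (walkFactor x * b)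
                           restorations-bound)
          where
          length-restored≡ : length restored ≡ Σ< M (λ l → Σ< M (λ d → length (restorations l d)))
          length-restored≡ = trans (length-concat< M _) (Σ<-cong M (λ l → length-concat< M (restorations l)))

        counted-step-inequality : ∀ {a} → HasSize (IsColoring G L S) a →
                                  K₁ₓ * (b * length (L x)) ≤ K₁ₓ * a + K₂ₓ * (walkFactor x * b)
        counted-step-inequality {a} (cs-S , _ , |cs-S|≡a , S⇔) = begin
          K₁ₓ * (b * length (L x))                ≡⟨ cong (λ b′ → K₁ₓ * (b′ * length (L x))) |cs-X|≡b ⟨
          K₁ₓ * (length cs-X * length (L x))      ≡⟨ cong (K₁ₓ *_) (length-extensions cs-X) ⟨
          K₁ₓ * length (extensions cs-X)          ≤⟨ *-monoʳ-≤ K₁ₓ (length-≤-⊆ (Unique-extensions unique-X x-free) classified) ⟩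
          K₁ₓ * length (cs-S ++ restored)         ≡⟨ cong (K₁ₓ *_) (length-++ cs-S) ⟩
          K₁ₓ * (length cs-S + length restored)   ≡⟨ *-distribˡ-+ K₁ₓ (length cs-S) (length restored) ⟩
          K₁ₓ * length cs-S + K₁ₓ * length restored
                                                  ≤⟨ +-mono-≤ (≤-reflexive (cong (K₁ₓ *_) |cs-S|≡a)) length-restored ⟩
          K₁ₓ * a + K₂ₓ * (walkFactor x * b)      ∎
          where
          open ≤-Reasoning
          cs-X = proj₁ size-xS
          unique-X = proj₁ (proj₂ size-xS)
          |cs-X|≡b = proj₁ (proj₂ (proj₂ size-xS))
          colors-X : ∀ {c} → c ∈ cs-X → IsColoring G L (x ∷ S) c
          colors-X {c} c∈ = Equivalence.from (proj₂ (proj₂ (proj₂ size-xS)) c) c∈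
          x-free : ∀ {c} → c ∈ cs-X → col G c x ≡ nothing
          x-free c∈ = proj₁ (colors-X c∈) x (here refl)
          classified : extensions cs-X ⊆ cs-S ++ restored
          classified e∈ with ∈-map⁻ _ e∈
          ... | (c , κ) , cκ∈ , refl with ∈-cartesianProduct⁻ cs-X (L x) cκ∈
          ... | c∈ , κ∈ with extension-restored-or-colors enum-spec (colors-X c∈) κ∈
          ... | inj₁ e∈restored = ∈-++⁺ʳ cs-S e∈restored
          ... | inj₂ e-colors   = ∈-++⁺ˡ (Equivalence.to (S⇔ _) e-colors)

    step-inequality : (∀ S′ → x ∷ S ⊆ S′ → ∀ y → y ∉ S′ → Claim S′ y) → ⦃ _ : NonZero Δ ⦄ →
                      ∀ {a b} → HasSize (IsColoring G L S) a → HasSize (IsColoring G L (x ∷ S)) b →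
                      K₁ₓ * (b * length (L x)) ≤ K₁ₓ * a + K₂ₓ * (walkFactor x * b)
    step-inequality ih size-S size-xS = decidable-stable (_ ≤? _) (do
      enum , enum-spec ← ¬¬-choice (≡-dec _≟ᴱ_) [] deletedSets ¬¬-enumeration-IsColoring
      pure (Restorations.Count.counted-step-inequality enum enum-spec ih size-xS size-S))

-- The induction

-- With ℓ ≥ 4.25Δ, a bad fraction K₂/K₁ ≤ 2.63 of Δ leaves 4.25 − 2.63 = 1.62.
vertex-ratio : ∀ Δ K₁ K₂ a b ℓ ⦃ _ : NonZero K₁ ⦄ → 400 * K₂ ≤ 1052 * K₁ → 17 * Δ ≤ 4 * ℓ →
               K₁ * (b * ℓ) ≤ K₁ * a + K₂ * (Δ * b) → 162 * Δ * b ≤ 100 * a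
vertex-ratio Δ K₁ K₂ a b ℓ K₂≤ ℓ≥ step = *-cancelˡ-≤ 4 (*-cancelˡ-≤ K₁ (+-cancelʳ-≤ (K₁ * (1052 * u)) _ _ (begin
  K₁ * (4 * (162 * Δ * b)) + K₁ * (1052 * u) ≡⟨ 1700≡648+1052 K₁ Δ b ⟩
  K₁ * (100 * (17 * Δ) * b)                  ≤⟨ *-monoʳ-≤ K₁ (*-monoˡ-≤ b (*-monoʳ-≤ 100 ℓ≥)) ⟩
  K₁ * (100 * (4 * ℓ) * b)                   ≡⟨ pull-400 K₁ ℓ b ⟩
  400 * (K₁ * (b * ℓ))                       ≤⟨ *-monoʳ-≤ 400 step ⟩
  400 * (K₁ * a + K₂ * u)                    ≡⟨ distribute-400 K₁ a K₂ u ⟩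
  K₁ * (4 * (100 * a)) + 400 * K₂ * u        ≤⟨ +-monoʳ-≤ (K₁ * (4 * (100 * a))) (*-monoˡ-≤ u K₂≤) ⟩
  K₁ * (4 * (100 * a)) + 1052 * K₁ * u       ≡⟨ cong (K₁ * (4 * (100 * a)) +_) (commute-1052 K₁ u) ⟩
  K₁ * (4 * (100 * a)) + K₁ * (1052 * u)     ∎)))
  where
  open ≤-Reasoning
  u = Δ * b
  1700≡648+1052 : ∀ K D b → K * (4 * (162 * D * b)) + K * (1052 * (D * b)) ≡ K * (100 * (17 * D) * b)
  1700≡648+1052 = solve-∀
  pull-400 : ∀ K ℓ b → K * (100 * (4 * ℓ) * b) ≡ 400 * (K * (b * ℓ))
  pull-400 = solve-∀
  distribute-400 : ∀ K a K′ u → 400 * (K * a + K′ * u) ≡ K * (4 * (100 * a)) + 400 * K′ * u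
  distribute-400 = solve-∀
  commute-1052 : ∀ K u → 1052 * K * u ≡ K * (1052 * u)
  commute-1052 = solve-∀

-- With ℓ ≥ 4.25Δ, a bad fraction 4K₂/K₁ ≤ 15 ≤ 0.05Δ leaves 4.25 − 0.05 = 4.2.
edge-ratio : ∀ Δ K₁ K₂ a b ℓ ⦃ _ : NonZero K₁ ⦄ → 300 ≤ Δ → 160 * K₂ ≤ 600 * K₁ → 17 * Δ ≤ 4 * ℓ →
             K₁ * (b * ℓ) ≤ K₁ * a + K₂ * (4 * b) → 42 * Δ * b ≤ 10 * a
edge-ratio Δ K₁ K₂ a b ℓ Δ≥300 K₂≤ ℓ≥ step = *-cancelˡ-≤ 4 (*-cancelˡ-≤ K₁ (+-cancelʳ-≤ (K₁ * (2 * (Δ * b))) _ _ (begin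
  K₁ * (4 * (42 * Δ * b)) + K₁ * (2 * (Δ * b)) ≡⟨ 170≡168+2 K₁ Δ b ⟩
  K₁ * (10 * (17 * Δ) * b)                     ≤⟨ *-monoʳ-≤ K₁ (*-monoˡ-≤ b (*-monoʳ-≤ 10 ℓ≥)) ⟩
  K₁ * (10 * (4 * ℓ) * b)                      ≡⟨ pull-40 K₁ ℓ b ⟩
  40 * (K₁ * (b * ℓ))                          ≤⟨ *-monoʳ-≤ 40 step ⟩
  40 * (K₁ * a + K₂ * (4 * b))                 ≡⟨ distribute-40 K₁ a K₂ b ⟩
  K₁ * (4 * (10 * a)) + 160 * K₂ * b           ≤⟨ +-monoʳ-≤ (K₁ * (4 * (10 * a))) (*-monoˡ-≤ b K₂≤) ⟩
  K₁ * (4 * (10 * a)) + 600 * K₁ * b           ≡⟨ cong (K₁ * (4 * (10 * a)) +_) (split-600 K₁ b) ⟩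
  K₁ * (4 * (10 * a)) + K₁ * (2 * (300 * b))   ≤⟨ +-monoʳ-≤ (K₁ * (4 * (10 * a))) (*-monoʳ-≤ K₁ (*-monoʳ-≤ 2 (*-monoˡ-≤ b Δ≥300))) ⟩
  K₁ * (4 * (10 * a)) + K₁ * (2 * (Δ * b))     ∎)))
  where
  open ≤-Reasoning
  170≡168+2 : ∀ K D b → K * (4 * (42 * D * b)) + K * (2 * (D * b)) ≡ K * (10 * (17 * D) * b)
  170≡168+2 = solve-∀
  pull-40 : ∀ K ℓ b → K * (10 * (4 * ℓ) * b) ≡ 40 * (K * (b * ℓ))
  pull-40 = solve-∀
  distribute-40 : ∀ K a K′ b → 40 * (K * a + K′ * (4 * b)) ≡ K * (4 * (10 * a)) + 160 * K′ * b
  distribute-40 = solve-∀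
  split-600 : ∀ K b → 600 * K * b ≡ K * (2 * (300 * b))
  split-600 = solve-∀

module Main (Δ : ℕ) (Δ≥300 : 300 ≤ Δ) (G : Graph) (deg<Δ : ∀ v → deg G v < Δ)
            (L : Elt G → List ℕ) (L-unique : ∀ y → Unique (L y)) (L-large : ∀ y → 17 * Δ ≤ 4 * length (L y)) where

  open Walks G using (isVertex)
  open WalkCount G Δ deg<Δ using (walkFactor)
  open Colorings G L
  open Extension G Δ deg<Δ L L-unique

  instance
    Δ≢0 : NonZero Δ
    Δ≢0 = >-nonZero (≤-trans (s≤s z≤n) Δ≥300)

  claim-from-step : ∀ {S} x →
                    (∀ {a b} → HasSize (IsColoring G L S) a → HasSize (IsColoring G L (x ∷ S)) b →
                       let t = not (isVertex x) in K₁ t * (b * length (L x)) ≤ K₁ t * a + K₂ t * (walkFactor x * b)) →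
                    Claim S x
  claim-from-step (inj₁ v) step a b size-S size-xS =
    vertex-ratio Δ (K₁ false) (K₂ false) a b _ (toWitness {a? = _ ≤? _} tt) (L-large (inj₁ v)) (step size-S size-xS)
  claim-from-step (inj₂ e) step a b size-S size-xS =
    edge-ratio Δ (K₁ true) (K₂ true) a b _ Δ≥300 (toWitness {a? = _ ≤? _} tt) (L-large (inj₂ e)) (step size-S size-xS)

  claim : ∀ S x → x ∉ S → Claim S x
  claim = WF.All.wfRec (On.wellFounded (λ S → length (undeleted S)) <-wellFounded) _ (λ S → ∀ x → x ∉ S → Claim S x)
            λ S rec x x∉S → claim-from-step x (step-inequality S x x∉S λ S′ xS⊆S′ →
                              rec (length-undeleted-< (λ y∈S → xS⊆S′ (there y∈S)) (xS⊆S′ (here refl)) x∉S))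

lemma4 : (Δ : ℕ) → 300 ≤ Δ → (G : Graph) → (∀ v → deg G v < Δ)
  → (L : Elt G → List ℕ) → (∀ y → Unique (L y)) → (∀ y → 17 * Δ ≤ 4 * length (L y))
  → (∀ v a b → HasSize (IsColoring G L []) a → HasSize (IsColoring G L (inj₁ v ∷ [])) b
       → 162 * Δ * b ≤ 100 * a)
  × (∀ e a b → HasSize (IsColoring G L []) a → HasSize (IsColoring G L (inj₂ e ∷ [])) b
       → 42 * Δ * b ≤ 10 * a)
lemma4 Δ Δ≥300 G deg<Δ L L-unique L-large = (λ v → claim [] (inj₁ v) λ ()) , (λ e → claim [] (inj₂ e) λ ())
  where open Main Δ Δ≥300 G deg<Δ L L-unique L-large
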